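{- A finite de Morgan algebra $\mathbf{M}$ is a perfect extension of its Boolean skeleton $B(\mathbf{M})$ if and only if $\mathbf{M}$ is isomorphic to a direct product of finitely many algebras each of which is a copy of $\{0,1\}$, of $\{0,a,1\}$, or of $\mathbf{M}_1$.
   Context: A de Morgan algebra is an algebra $(M;\vee,\wedge,{}^\circ,0,1)$ where $(M;\vee,\wedge,0,1)$ is a bounded distributive lattice and ${}^\circ$ is a unary operation satisfying $(x\wedge y)^\circ=x^\circ\vee y^\circ$, $1^\circ=0$ and $x^{\circ\circ}=x$. Its Boolean skeleton is the subalgebra $B(\mathbf{M})=\{x\in M\mid x\vee x^\circ=1\}$. An algebra $\mathbf{A}$ is a perfect extension of a subalgebra $\mathbf{B}$ if every congruence of $\mathbf{B}$ has exactly one extension to a congruence of $\mathbf{A}$. $\mathbf{M}_1$ is the four-element de Morgan algebra on $\{0,a,b,1\}$ with lattice order $0<a<1$, $0<b<1$, $a,b$ incomparable, and $0^\circ=1$, $1^\circ=0$, $a^\circ=a$, $b^\circ=b$; $\{0,a,1\}$ and $\{0,1\}$ are its subalgebras. -}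

module Defs where

open import Level using (0ℓ) renaming (suc to lsuc)
open import Data.Nat using (ℕ)
open import Data.Fin using (Fin)
open import Data.Unit using (⊤; tt)
open import Data.Product using (Σ; ∃; _×_; _,_; proj₁; proj₂)
open import Data.List using (List; []; _∷_)
open import Relation.Binary.Core using (Rel)
open import Relation.Binary.Structures using (IsEquivalence)
open import Relation.Binary.PropositionalEquality
  using (_≡_; refl; cong; cong₂; sym; trans)
open import Function.Bundles using (_↔_; _⇔_)
open import Function.Definitions using (Bijective)

record DMOps : Set₁ where
  infixr 6 _∨_
  infixr 7 _∧_
  field
    Carrier : Set
    _∨_ _∧_ : Carrier → Carrier → Carrier
    _°      : Carrier → Carrier
    0# 1#   : Carrier

record IsDeMorgan (A : DMOps) : Set where
  open DMOps A
  field
    ∨-assoc      : ∀ x y z → ((x ∨ y) ∨ z) ≡ (x ∨ (y ∨ z))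
    ∨-comm       : ∀ x y → (x ∨ y) ≡ (y ∨ x)
    ∧-assoc      : ∀ x y z → ((x ∧ y) ∧ z) ≡ (x ∧ (y ∧ z))
    ∧-comm       : ∀ x y → (x ∧ y) ≡ (y ∧ x)
    ∨-absorbs-∧  : ∀ x y → (x ∨ (x ∧ y)) ≡ x
    ∧-absorbs-∨  : ∀ x y → (x ∧ (x ∨ y)) ≡ x
    ∧-distrib-∨  : ∀ x y z → (x ∧ (y ∨ z)) ≡ ((x ∧ y) ∨ (x ∧ z))
    ∨-identity   : ∀ x → (x ∨ 0#) ≡ x
    ∧-identity   : ∀ x → (x ∧ 1#) ≡ x
    °-deMorgan   : ∀ x y → ((x ∧ y) °) ≡ ((x °) ∨ (y °))
    °-1          : (1# °) ≡ 0#
    °-involutive : ∀ x → ((x °) °) ≡ x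

record DeMorgan : Set₁ where
  field
    ops        : DMOps
    isDeMorgan : IsDeMorgan ops
  open DMOps ops public
  open IsDeMorgan isDeMorgan public

Finite : DeMorgan → Set
Finite M = ∃ λ (n : ℕ) → DeMorgan.Carrier M ↔ Fin n

record Congruence (A : DMOps) : Set₁ where
  open DMOps A
  field
    _≈_     : Rel Carrier 0ℓ
    isEquiv : IsEquivalence _≈_
    ∨-cong  : ∀ {x y u v} → x ≈ y → u ≈ v → (x ∨ u) ≈ (y ∨ v)
    ∧-cong  : ∀ {x y u v} → x ≈ y → u ≈ v → (x ∧ u) ≈ (y ∧ v)
    °-cong  : ∀ {x y} → x ≈ y → (x °) ≈ (y °)

SameCongruence : {A : DMOps} → Congruence A → Congruence A → Set
SameCongruence {A} θ φ =
  ∀ (x y : DMOps.Carrier A) → (Congruence._≈_ θ x y ⇔ Congruence._≈_ φ x y)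

module Skeleton (M : DeMorgan) where
  open DeMorgan M

  InB : Carrier → Set
  InB x = (x ∨ (x °)) ≡ 1#

  private
    ∨-idemˡ : ∀ x → (1# ∨ x) ≡ 1#
    ∨-idemˡ x = trans (cong (1# ∨_) (sym (trans (∧-comm 1# x) (∧-identity x))))
                      (∨-absorbs-∧ 1# x)

    °-0 : (0# °) ≡ 1#
    °-0 = trans (cong _° (sym °-1)) (°-involutive 1#)

    °-deMorgan-∨ : ∀ x y → ((x ∨ y) °) ≡ ((x °) ∧ (y °))
    °-deMorgan-∨ x y =
      trans (cong _° (cong₂ _∨_ (sym (°-involutive x)) (sym (°-involutive y))))
      (trans (cong _° (sym (°-deMorgan (x °) (y °))))
             (°-involutive ((x °) ∧ (y °))))

    ∨-distrib-∧ : ∀ x y z → (x ∨ (y ∧ z)) ≡ ((x ∨ y) ∧ (x ∨ z))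
    ∨-distrib-∧ x y z = sym (begin
        (x ∨ y) ∧ (x ∨ z)
      ≡⟨ ∧-distrib-∨ (x ∨ y) x z ⟩
        ((x ∨ y) ∧ x) ∨ ((x ∨ y) ∧ z)
      ≡⟨ cong₂ _∨_ (trans (∧-comm (x ∨ y) x) (∧-absorbs-∨ x y)) (∧-comm (x ∨ y) z) ⟩
        x ∨ (z ∧ (x ∨ y))
      ≡⟨ cong (x ∨_) (∧-distrib-∨ z x y) ⟩
        x ∨ ((z ∧ x) ∨ (z ∧ y))
      ≡⟨ sym (∨-assoc x (z ∧ x) (z ∧ y)) ⟩
        (x ∨ (z ∧ x)) ∨ (z ∧ y)
      ≡⟨ cong₂ _∨_ (trans (cong (x ∨_) (∧-comm z x)) (∨-absorbs-∧ x z)) (∧-comm z y) ⟩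
        x ∨ (y ∧ z) ∎)
      where open Relation.Binary.PropositionalEquality.≡-Reasoning

    top : ∀ a b → InB b → (a ∨ (b ∨ (b °))) ≡ 1#
    top a b p = trans (cong (a ∨_) p)
                      (trans (∨-comm a 1#) (∨-idemˡ a))

  0∈B : InB 0#
  0∈B = trans (cong (0# ∨_) °-0) (trans (∨-comm 0# 1#) (∨-idemˡ 0#))

  1∈B : InB 1#
  1∈B = ∨-idemˡ (1# °)

  °∈B : ∀ {x} → InB x → InB (x °)
  °∈B {x} p = trans (cong ((x °) ∨_) (°-involutive x)) (trans (∨-comm (x °) x) p)

  ∨∈B : ∀ {x y} → InB x → InB y → InB (x ∨ y)
  ∨∈B {x} {y} p q = begin
      (x ∨ y) ∨ ((x ∨ y) °)
    ≡⟨ cong ((x ∨ y) ∨_) (°-deMorgan-∨ x y) ⟩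
      (x ∨ y) ∨ ((x °) ∧ (y °))
    ≡⟨ ∨-distrib-∧ (x ∨ y) (x °) (y °) ⟩
      ((x ∨ y) ∨ (x °)) ∧ ((x ∨ y) ∨ (y °))
    ≡⟨ cong₂ _∧_ (trans (cong (_∨ (x °)) (∨-comm x y))
                  (trans (∨-assoc y x (x °)) (top y x p)))
                 (trans (∨-assoc x y (y °)) (top x y q)) ⟩
      1# ∧ 1#
    ≡⟨ ∧-identity 1# ⟩
      1# ∎
    where open Relation.Binary.PropositionalEquality.≡-Reasoning

  ∧∈B : ∀ {x y} → InB x → InB y → InB (x ∧ y)
  ∧∈B {x} {y} p q = begin
      (x ∧ y) ∨ ((x ∧ y) °)
    ≡⟨ cong ((x ∧ y) ∨_) (°-deMorgan x y) ⟩
      (x ∧ y) ∨ ((x °) ∨ (y °))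
    ≡⟨ ∨-comm (x ∧ y) ((x °) ∨ (y °)) ⟩
      ((x °) ∨ (y °)) ∨ (x ∧ y)
    ≡⟨ ∨-distrib-∧ ((x °) ∨ (y °)) x y ⟩
      (((x °) ∨ (y °)) ∨ x) ∧ (((x °) ∨ (y °)) ∨ y)
    ≡⟨ cong₂ _∧_ e₁ e₂ ⟩
      1# ∧ 1#
    ≡⟨ ∧-identity 1# ⟩
      1# ∎
    where
    open Relation.Binary.PropositionalEquality.≡-Reasoning
    e₁ : (((x °) ∨ (y °)) ∨ x) ≡ 1#
    e₁ = trans (∨-comm ((x °) ∨ (y °)) x)
         (trans (sym (∨-assoc x (x °) (y °)))
         (trans (cong (_∨ (y °)) p) (∨-idemˡ (y °))))
    e₂ : (((x °) ∨ (y °)) ∨ y) ≡ 1#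
    e₂ = trans (∨-assoc (x °) (y °) y)
         (trans (cong ((x °) ∨_) (∨-comm (y °) y)) (top (x °) y q))

  B : DMOps
  B = record
    { Carrier = Σ Carrier InB
    ; _∨_ = λ { (x , p) (y , q) → (x ∨ y) , ∨∈B p q }
    ; _∧_ = λ { (x , p) (y , q) → (x ∧ y) , ∧∈B p q }
    ; _° = λ { (x , p) → (x °) , °∈B p }
    ; 0# = 0# , 0∈B
    ; 1# = 1# , 1∈B
    }

  Extends : Congruence B → Congruence ops → Set
  Extends θ Φ = ∀ (x y : Σ Carrier InB) →
    (Congruence._≈_ θ x y ⇔ Congruence._≈_ Φ (proj₁ x) (proj₁ y))

PerfectExtensionOfSkeleton : DeMorgan → Set₁
PerfectExtensionOfSkeleton M =
  ∀ (θ : Congruence B) →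
    Σ (Congruence (DeMorgan.ops M)) λ Φ →
      Extends θ Φ × (∀ (Ψ : Congruence (DeMorgan.ops M)) → Extends θ Ψ → SameCongruence Φ Ψ)
  where open Skeleton M

record IsHomomorphism (M N : DeMorgan) (f : DeMorgan.Carrier M → DeMorgan.Carrier N) : Set where
  private
    module M = DeMorgan M
    module N = DeMorgan N
  field
    ∨-homo : ∀ x y → f (x M.∨ y) ≡ (f x N.∨ f y)
    ∧-homo : ∀ x y → f (x M.∧ y) ≡ (f x N.∧ f y)
    °-homo : ∀ x → f (x M.°) ≡ (f x N.°)
    0-homo : f M.0# ≡ N.0#
    1-homo : f M.1# ≡ N.1#

_≅_ : DeMorgan → DeMorgan → Set
M ≅ N = Σ (DeMorgan.Carrier M → DeMorgan.Carrier N) λ f →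
          IsHomomorphism M N f × Bijective _≡_ _≡_ f

opsUnit : DMOps
opsUnit = record { Carrier = ⊤ ; _∨_ = λ _ _ → tt ; _∧_ = λ _ _ → tt ; _° = λ _ → tt ; 0# = tt ; 1# = tt }

Unit : DeMorgan
Unit = record { ops = opsUnit ; isDeMorgan = record
  { ∨-assoc = λ _ _ _ → refl ; ∨-comm = λ _ _ → refl ; ∧-assoc = λ _ _ _ → refl
  ; ∧-comm = λ _ _ → refl ; ∨-absorbs-∧ = λ _ _ → refl ; ∧-absorbs-∨ = λ _ _ → refl
  ; ∧-distrib-∨ = λ _ _ _ → refl ; ∨-identity = λ _ → refl ; ∧-identity = λ _ → refl
  ; °-deMorgan = λ _ _ → refl ; °-1 = refl ; °-involutive = λ _ → refl } }

_⊗_ : DeMorgan → DeMorgan → DeMorgan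
M ⊗ N = record { ops = o ; isDeMorgan = record
  { ∨-assoc = λ { (a , b) (c , d) (e , f) → cong₂ _,_ (M.∨-assoc a c e) (N.∨-assoc b d f) }
  ; ∨-comm = λ { (a , b) (c , d) → cong₂ _,_ (M.∨-comm a c) (N.∨-comm b d) }
  ; ∧-assoc = λ { (a , b) (c , d) (e , f) → cong₂ _,_ (M.∧-assoc a c e) (N.∧-assoc b d f) }
  ; ∧-comm = λ { (a , b) (c , d) → cong₂ _,_ (M.∧-comm a c) (N.∧-comm b d) }
  ; ∨-absorbs-∧ = λ { (a , b) (c , d) → cong₂ _,_ (M.∨-absorbs-∧ a c) (N.∨-absorbs-∧ b d) }
  ; ∧-absorbs-∨ = λ { (a , b) (c , d) → cong₂ _,_ (M.∧-absorbs-∨ a c) (N.∧-absorbs-∨ b d) }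
  ; ∧-distrib-∨ = λ { (a , b) (c , d) (e , f) → cong₂ _,_ (M.∧-distrib-∨ a c e) (N.∧-distrib-∨ b d f) }
  ; ∨-identity = λ { (a , b) → cong₂ _,_ (M.∨-identity a) (N.∨-identity b) }
  ; ∧-identity = λ { (a , b) → cong₂ _,_ (M.∧-identity a) (N.∧-identity b) }
  ; °-deMorgan = λ { (a , b) (c , d) → cong₂ _,_ (M.°-deMorgan a c) (N.°-deMorgan b d) }
  ; °-1 = cong₂ _,_ M.°-1 N.°-1
  ; °-involutive = λ { (a , b) → cong₂ _,_ (M.°-involutive a) (N.°-involutive b) } } }
  where
  module M = DeMorgan M
  module N = DeMorgan N
  o : DMOps
  o = record
    { Carrier = M.Carrier × N.Carrier
    ; _∨_ = λ { (a , b) (c , d) → (a M.∨ c) , (b N.∨ d) }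
    ; _∧_ = λ { (a , b) (c , d) → (a M.∧ c) , (b N.∧ d) }
    ; _° = λ { (a , b) → (a M.°) , (b N.°) }
    ; 0# = M.0# , N.0#
    ; 1# = M.1# , N.1#
    }

-- The three basic algebras: {0,1} (Two), {0,a,1} (Three), M₁ (Em)
-- Elements are listed bottom first, top last; order: o < a,b < i, a ∥ b.

data TwoE : Set where
  o2 i2 : TwoE

_∨Two_ : TwoE → TwoE → TwoE
o2 ∨Two o2 = o2
o2 ∨Two i2 = i2
i2 ∨Two o2 = i2
i2 ∨Two i2 = i2

_∧Two_ : TwoE → TwoE → TwoE
o2 ∧Two o2 = o2
o2 ∧Two i2 = o2
i2 ∧Two o2 = o2
i2 ∧Two i2 = i2

°Two : TwoE → TwoE
°Two o2 = i2
°Two i2 = o2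

opsTwo : DMOps
opsTwo = record { Carrier = TwoE ; _∨_ = _∨Two_ ; _∧_ = _∧Two_ ; _° = °Two ; 0# = o2 ; 1# = i2 }

isDMTwo : IsDeMorgan opsTwo
isDMTwo = record
  { ∨-assoc = Two-∨-assoc
  ; ∨-comm = Two-∨-comm
  ; ∧-assoc = Two-∧-assoc
  ; ∧-comm = Two-∧-comm
  ; ∨-absorbs-∧ = Two-∨-absorbs-∧
  ; ∧-absorbs-∨ = Two-∧-absorbs-∨
  ; ∧-distrib-∨ = Two-∧-distrib-∨
  ; ∨-identity = Two-∨-identity
  ; ∧-identity = Two-∧-identity
  ; °-deMorgan = Two-°-deMorgan
  ; °-1 = Two-°-1
  ; °-involutive = Two-°-involutive
  }
  where
  Two-∨-assoc : ∀ x y z → ((x ∨Two y) ∨Two z) ≡ (x ∨Two (y ∨Two z))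
  Two-∨-assoc o2 o2 o2 = refl
  Two-∨-assoc o2 o2 i2 = refl
  Two-∨-assoc o2 i2 o2 = refl
  Two-∨-assoc o2 i2 i2 = refl
  Two-∨-assoc i2 o2 o2 = refl
  Two-∨-assoc i2 o2 i2 = refl
  Two-∨-assoc i2 i2 o2 = refl
  Two-∨-assoc i2 i2 i2 = refl
  Two-∨-comm : ∀ x y → (x ∨Two y) ≡ (y ∨Two x)
  Two-∨-comm o2 o2 = refl
  Two-∨-comm o2 i2 = refl
  Two-∨-comm i2 o2 = refl
  Two-∨-comm i2 i2 = refl
  Two-∧-assoc : ∀ x y z → ((x ∧Two y) ∧Two z) ≡ (x ∧Two (y ∧Two z))
  Two-∧-assoc o2 o2 o2 = refl
  Two-∧-assoc o2 o2 i2 = refl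
  Two-∧-assoc o2 i2 o2 = refl
  Two-∧-assoc o2 i2 i2 = refl
  Two-∧-assoc i2 o2 o2 = refl
  Two-∧-assoc i2 o2 i2 = refl
  Two-∧-assoc i2 i2 o2 = refl
  Two-∧-assoc i2 i2 i2 = refl
  Two-∧-comm : ∀ x y → (x ∧Two y) ≡ (y ∧Two x)
  Two-∧-comm o2 o2 = refl
  Two-∧-comm o2 i2 = refl
  Two-∧-comm i2 o2 = refl
  Two-∧-comm i2 i2 = refl
  Two-∨-absorbs-∧ : ∀ x y → (x ∨Two (x ∧Two y)) ≡ x
  Two-∨-absorbs-∧ o2 o2 = refl
  Two-∨-absorbs-∧ o2 i2 = refl
  Two-∨-absorbs-∧ i2 o2 = refl
  Two-∨-absorbs-∧ i2 i2 = refl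
  Two-∧-absorbs-∨ : ∀ x y → (x ∧Two (x ∨Two y)) ≡ x
  Two-∧-absorbs-∨ o2 o2 = refl
  Two-∧-absorbs-∨ o2 i2 = refl
  Two-∧-absorbs-∨ i2 o2 = refl
  Two-∧-absorbs-∨ i2 i2 = refl
  Two-∧-distrib-∨ : ∀ x y z → (x ∧Two (y ∨Two z)) ≡ ((x ∧Two y) ∨Two (x ∧Two z))
  Two-∧-distrib-∨ o2 o2 o2 = refl
  Two-∧-distrib-∨ o2 o2 i2 = refl
  Two-∧-distrib-∨ o2 i2 o2 = refl
  Two-∧-distrib-∨ o2 i2 i2 = refl
  Two-∧-distrib-∨ i2 o2 o2 = refl
  Two-∧-distrib-∨ i2 o2 i2 = refl
  Two-∧-distrib-∨ i2 i2 o2 = refl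
  Two-∧-distrib-∨ i2 i2 i2 = refl
  Two-∨-identity : ∀ x → (x ∨Two o2) ≡ x
  Two-∨-identity o2 = refl
  Two-∨-identity i2 = refl
  Two-∧-identity : ∀ x → (x ∧Two i2) ≡ x
  Two-∧-identity o2 = refl
  Two-∧-identity i2 = refl
  Two-°-deMorgan : ∀ x y → (°Two (x ∧Two y)) ≡ ((°Two x) ∨Two (°Two y))
  Two-°-deMorgan o2 o2 = refl
  Two-°-deMorgan o2 i2 = refl
  Two-°-deMorgan i2 o2 = refl
  Two-°-deMorgan i2 i2 = refl
  Two-°-1 : (°Two i2) ≡ o2
  Two-°-1  = refl
  Two-°-involutive : ∀ x → (°Two (°Two x)) ≡ x
  Two-°-involutive o2 = refl
  Two-°-involutive i2 = refl

Two : DeMorgan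
Two = record { ops = opsTwo ; isDeMorgan = isDMTwo }

data ThreeE : Set where
  o3 a3 i3 : ThreeE

_∨Three_ : ThreeE → ThreeE → ThreeE
o3 ∨Three o3 = o3
o3 ∨Three a3 = a3
o3 ∨Three i3 = i3
a3 ∨Three o3 = a3
a3 ∨Three a3 = a3
a3 ∨Three i3 = i3
i3 ∨Three o3 = i3
i3 ∨Three a3 = i3
i3 ∨Three i3 = i3

_∧Three_ : ThreeE → ThreeE → ThreeE
o3 ∧Three o3 = o3
o3 ∧Three a3 = o3
o3 ∧Three i3 = o3
a3 ∧Three o3 = o3
a3 ∧Three a3 = a3
a3 ∧Three i3 = a3
i3 ∧Three o3 = o3
i3 ∧Three a3 = a3
i3 ∧Three i3 = i3

°Three : ThreeE → ThreeE
°Three o3 = i3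
°Three a3 = a3
°Three i3 = o3

opsThree : DMOps
opsThree = record { Carrier = ThreeE ; _∨_ = _∨Three_ ; _∧_ = _∧Three_ ; _° = °Three ; 0# = o3 ; 1# = i3 }

isDMThree : IsDeMorgan opsThree
isDMThree = record
  { ∨-assoc = Three-∨-assoc
  ; ∨-comm = Three-∨-comm
  ; ∧-assoc = Three-∧-assoc
  ; ∧-comm = Three-∧-comm
  ; ∨-absorbs-∧ = Three-∨-absorbs-∧
  ; ∧-absorbs-∨ = Three-∧-absorbs-∨
  ; ∧-distrib-∨ = Three-∧-distrib-∨
  ; ∨-identity = Three-∨-identity
  ; ∧-identity = Three-∧-identity
  ; °-deMorgan = Three-°-deMorgan
  ; °-1 = Three-°-1
  ; °-involutive = Three-°-involutive
  }
  where
  Three-∨-assoc : ∀ x y z → ((x ∨Three y) ∨Three z) ≡ (x ∨Three (y ∨Three z))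
  Three-∨-assoc o3 o3 o3 = refl
  Three-∨-assoc o3 o3 a3 = refl
  Three-∨-assoc o3 o3 i3 = refl
  Three-∨-assoc o3 a3 o3 = refl
  Three-∨-assoc o3 a3 a3 = refl
  Three-∨-assoc o3 a3 i3 = refl
  Three-∨-assoc o3 i3 o3 = refl
  Three-∨-assoc o3 i3 a3 = refl
  Three-∨-assoc o3 i3 i3 = refl
  Three-∨-assoc a3 o3 o3 = refl
  Three-∨-assoc a3 o3 a3 = refl
  Three-∨-assoc a3 o3 i3 = refl
  Three-∨-assoc a3 a3 o3 = refl
  Three-∨-assoc a3 a3 a3 = refl
  Three-∨-assoc a3 a3 i3 = refl
  Three-∨-assoc a3 i3 o3 = refl
  Three-∨-assoc a3 i3 a3 = refl
  Three-∨-assoc a3 i3 i3 = refl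
  Three-∨-assoc i3 o3 o3 = refl
  Three-∨-assoc i3 o3 a3 = refl
  Three-∨-assoc i3 o3 i3 = refl
  Three-∨-assoc i3 a3 o3 = refl
  Three-∨-assoc i3 a3 a3 = refl
  Three-∨-assoc i3 a3 i3 = refl
  Three-∨-assoc i3 i3 o3 = refl
  Three-∨-assoc i3 i3 a3 = refl
  Three-∨-assoc i3 i3 i3 = refl
  Three-∨-comm : ∀ x y → (x ∨Three y) ≡ (y ∨Three x)
  Three-∨-comm o3 o3 = refl
  Three-∨-comm o3 a3 = refl
  Three-∨-comm o3 i3 = refl
  Three-∨-comm a3 o3 = refl
  Three-∨-comm a3 a3 = refl
  Three-∨-comm a3 i3 = refl
  Three-∨-comm i3 o3 = refl
  Three-∨-comm i3 a3 = refl
  Three-∨-comm i3 i3 = refl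
  Three-∧-assoc : ∀ x y z → ((x ∧Three y) ∧Three z) ≡ (x ∧Three (y ∧Three z))
  Three-∧-assoc o3 o3 o3 = refl
  Three-∧-assoc o3 o3 a3 = refl
  Three-∧-assoc o3 o3 i3 = refl
  Three-∧-assoc o3 a3 o3 = refl
  Three-∧-assoc o3 a3 a3 = refl
  Three-∧-assoc o3 a3 i3 = refl
  Three-∧-assoc o3 i3 o3 = refl
  Three-∧-assoc o3 i3 a3 = refl
  Three-∧-assoc o3 i3 i3 = refl
  Three-∧-assoc a3 o3 o3 = refl
  Three-∧-assoc a3 o3 a3 = refl
  Three-∧-assoc a3 o3 i3 = refl
  Three-∧-assoc a3 a3 o3 = refl
  Three-∧-assoc a3 a3 a3 = refl
  Three-∧-assoc a3 a3 i3 = refl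
  Three-∧-assoc a3 i3 o3 = refl
  Three-∧-assoc a3 i3 a3 = refl
  Three-∧-assoc a3 i3 i3 = refl
  Three-∧-assoc i3 o3 o3 = refl
  Three-∧-assoc i3 o3 a3 = refl
  Three-∧-assoc i3 o3 i3 = refl
  Three-∧-assoc i3 a3 o3 = refl
  Three-∧-assoc i3 a3 a3 = refl
  Three-∧-assoc i3 a3 i3 = refl
  Three-∧-assoc i3 i3 o3 = refl
  Three-∧-assoc i3 i3 a3 = refl
  Three-∧-assoc i3 i3 i3 = refl
  Three-∧-comm : ∀ x y → (x ∧Three y) ≡ (y ∧Three x)
  Three-∧-comm o3 o3 = refl
  Three-∧-comm o3 a3 = refl
  Three-∧-comm o3 i3 = refl
  Three-∧-comm a3 o3 = refl
  Three-∧-comm a3 a3 = refl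
  Three-∧-comm a3 i3 = refl
  Three-∧-comm i3 o3 = refl
  Three-∧-comm i3 a3 = refl
  Three-∧-comm i3 i3 = refl
  Three-∨-absorbs-∧ : ∀ x y → (x ∨Three (x ∧Three y)) ≡ x
  Three-∨-absorbs-∧ o3 o3 = refl
  Three-∨-absorbs-∧ o3 a3 = refl
  Three-∨-absorbs-∧ o3 i3 = refl
  Three-∨-absorbs-∧ a3 o3 = refl
  Three-∨-absorbs-∧ a3 a3 = refl
  Three-∨-absorbs-∧ a3 i3 = refl
  Three-∨-absorbs-∧ i3 o3 = refl
  Three-∨-absorbs-∧ i3 a3 = refl
  Three-∨-absorbs-∧ i3 i3 = refl
  Three-∧-absorbs-∨ : ∀ x y → (x ∧Three (x ∨Three y)) ≡ x
  Three-∧-absorbs-∨ o3 o3 = refl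
  Three-∧-absorbs-∨ o3 a3 = refl
  Three-∧-absorbs-∨ o3 i3 = refl
  Three-∧-absorbs-∨ a3 o3 = refl
  Three-∧-absorbs-∨ a3 a3 = refl
  Three-∧-absorbs-∨ a3 i3 = refl
  Three-∧-absorbs-∨ i3 o3 = refl
  Three-∧-absorbs-∨ i3 a3 = refl
  Three-∧-absorbs-∨ i3 i3 = refl
  Three-∧-distrib-∨ : ∀ x y z → (x ∧Three (y ∨Three z)) ≡ ((x ∧Three y) ∨Three (x ∧Three z))
  Three-∧-distrib-∨ o3 o3 o3 = refl
  Three-∧-distrib-∨ o3 o3 a3 = refl
  Three-∧-distrib-∨ o3 o3 i3 = refl
  Three-∧-distrib-∨ o3 a3 o3 = refl
  Three-∧-distrib-∨ o3 a3 a3 = refl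
  Three-∧-distrib-∨ o3 a3 i3 = refl
  Three-∧-distrib-∨ o3 i3 o3 = refl
  Three-∧-distrib-∨ o3 i3 a3 = refl
  Three-∧-distrib-∨ o3 i3 i3 = refl
  Three-∧-distrib-∨ a3 o3 o3 = refl
  Three-∧-distrib-∨ a3 o3 a3 = refl
  Three-∧-distrib-∨ a3 o3 i3 = refl
  Three-∧-distrib-∨ a3 a3 o3 = refl
  Three-∧-distrib-∨ a3 a3 a3 = refl
  Three-∧-distrib-∨ a3 a3 i3 = refl
  Three-∧-distrib-∨ a3 i3 o3 = refl
  Three-∧-distrib-∨ a3 i3 a3 = refl
  Three-∧-distrib-∨ a3 i3 i3 = refl
  Three-∧-distrib-∨ i3 o3 o3 = refl
  Three-∧-distrib-∨ i3 o3 a3 = refl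
  Three-∧-distrib-∨ i3 o3 i3 = refl
  Three-∧-distrib-∨ i3 a3 o3 = refl
  Three-∧-distrib-∨ i3 a3 a3 = refl
  Three-∧-distrib-∨ i3 a3 i3 = refl
  Three-∧-distrib-∨ i3 i3 o3 = refl
  Three-∧-distrib-∨ i3 i3 a3 = refl
  Three-∧-distrib-∨ i3 i3 i3 = refl
  Three-∨-identity : ∀ x → (x ∨Three o3) ≡ x
  Three-∨-identity o3 = refl
  Three-∨-identity a3 = refl
  Three-∨-identity i3 = refl
  Three-∧-identity : ∀ x → (x ∧Three i3) ≡ x
  Three-∧-identity o3 = refl
  Three-∧-identity a3 = refl
  Three-∧-identity i3 = refl
  Three-°-deMorgan : ∀ x y → (°Three (x ∧Three y)) ≡ ((°Three x) ∨Three (°Three y))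
  Three-°-deMorgan o3 o3 = refl
  Three-°-deMorgan o3 a3 = refl
  Three-°-deMorgan o3 i3 = refl
  Three-°-deMorgan a3 o3 = refl
  Three-°-deMorgan a3 a3 = refl
  Three-°-deMorgan a3 i3 = refl
  Three-°-deMorgan i3 o3 = refl
  Three-°-deMorgan i3 a3 = refl
  Three-°-deMorgan i3 i3 = refl
  Three-°-1 : (°Three i3) ≡ o3
  Three-°-1  = refl
  Three-°-involutive : ∀ x → (°Three (°Three x)) ≡ x
  Three-°-involutive o3 = refl
  Three-°-involutive a3 = refl
  Three-°-involutive i3 = refl

Three : DeMorgan
Three = record { ops = opsThree ; isDeMorgan = isDMThree }

data EmE : Set where
  oM aM bM iM : EmE

_∨Em_ : EmE → EmE → EmE
oM ∨Em oM = oM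
oM ∨Em aM = aM
oM ∨Em bM = bM
oM ∨Em iM = iM
aM ∨Em oM = aM
aM ∨Em aM = aM
aM ∨Em bM = iM
aM ∨Em iM = iM
bM ∨Em oM = bM
bM ∨Em aM = iM
bM ∨Em bM = bM
bM ∨Em iM = iM
iM ∨Em oM = iM
iM ∨Em aM = iM
iM ∨Em bM = iM
iM ∨Em iM = iM

_∧Em_ : EmE → EmE → EmE
oM ∧Em oM = oM
oM ∧Em aM = oM
oM ∧Em bM = oM
oM ∧Em iM = oM
aM ∧Em oM = oM
aM ∧Em aM = aM
aM ∧Em bM = oM
aM ∧Em iM = aM
bM ∧Em oM = oM
bM ∧Em aM = oM
bM ∧Em bM = bM
bM ∧Em iM = bM
iM ∧Em oM = oM
iM ∧Em aM = aM
iM ∧Em bM = bM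
iM ∧Em iM = iM

°Em : EmE → EmE
°Em oM = iM
°Em aM = aM
°Em bM = bM
°Em iM = oM

opsEm : DMOps
opsEm = record { Carrier = EmE ; _∨_ = _∨Em_ ; _∧_ = _∧Em_ ; _° = °Em ; 0# = oM ; 1# = iM }

isDMEm : IsDeMorgan opsEm
isDMEm = record
  { ∨-assoc = Em-∨-assoc
  ; ∨-comm = Em-∨-comm
  ; ∧-assoc = Em-∧-assoc
  ; ∧-comm = Em-∧-comm
  ; ∨-absorbs-∧ = Em-∨-absorbs-∧
  ; ∧-absorbs-∨ = Em-∧-absorbs-∨
  ; ∧-distrib-∨ = Em-∧-distrib-∨
  ; ∨-identity = Em-∨-identity
  ; ∧-identity = Em-∧-identity
  ; °-deMorgan = Em-°-deMorgan
  ; °-1 = Em-°-1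
  ; °-involutive = Em-°-involutive
  }
  where
  Em-∨-assoc : ∀ x y z → ((x ∨Em y) ∨Em z) ≡ (x ∨Em (y ∨Em z))
  Em-∨-assoc oM oM oM = refl
  Em-∨-assoc oM oM aM = refl
  Em-∨-assoc oM oM bM = refl
  Em-∨-assoc oM oM iM = refl
  Em-∨-assoc oM aM oM = refl
  Em-∨-assoc oM aM aM = refl
  Em-∨-assoc oM aM bM = refl
  Em-∨-assoc oM aM iM = refl
  Em-∨-assoc oM bM oM = refl
  Em-∨-assoc oM bM aM = refl
  Em-∨-assoc oM bM bM = refl
  Em-∨-assoc oM bM iM = refl
  Em-∨-assoc oM iM oM = refl
  Em-∨-assoc oM iM aM = refl
  Em-∨-assoc oM iM bM = refl
  Em-∨-assoc oM iM iM = refl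
  Em-∨-assoc aM oM oM = refl
  Em-∨-assoc aM oM aM = refl
  Em-∨-assoc aM oM bM = refl
  Em-∨-assoc aM oM iM = refl
  Em-∨-assoc aM aM oM = refl
  Em-∨-assoc aM aM aM = refl
  Em-∨-assoc aM aM bM = refl
  Em-∨-assoc aM aM iM = refl
  Em-∨-assoc aM bM oM = refl
  Em-∨-assoc aM bM aM = refl
  Em-∨-assoc aM bM bM = refl
  Em-∨-assoc aM bM iM = refl
  Em-∨-assoc aM iM oM = refl
  Em-∨-assoc aM iM aM = refl
  Em-∨-assoc aM iM bM = refl
  Em-∨-assoc aM iM iM = refl
  Em-∨-assoc bM oM oM = refl
  Em-∨-assoc bM oM aM = refl
  Em-∨-assoc bM oM bM = refl
  Em-∨-assoc bM oM iM = refl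
  Em-∨-assoc bM aM oM = refl
  Em-∨-assoc bM aM aM = refl
  Em-∨-assoc bM aM bM = refl
  Em-∨-assoc bM aM iM = refl
  Em-∨-assoc bM bM oM = refl
  Em-∨-assoc bM bM aM = refl
  Em-∨-assoc bM bM bM = refl
  Em-∨-assoc bM bM iM = refl
  Em-∨-assoc bM iM oM = refl
  Em-∨-assoc bM iM aM = refl
  Em-∨-assoc bM iM bM = refl
  Em-∨-assoc bM iM iM = refl
  Em-∨-assoc iM oM oM = refl
  Em-∨-assoc iM oM aM = refl
  Em-∨-assoc iM oM bM = refl
  Em-∨-assoc iM oM iM = refl
  Em-∨-assoc iM aM oM = refl
  Em-∨-assoc iM aM aM = refl
  Em-∨-assoc iM aM bM = refl
  Em-∨-assoc iM aM iM = refl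
  Em-∨-assoc iM bM oM = refl
  Em-∨-assoc iM bM aM = refl
  Em-∨-assoc iM bM bM = refl
  Em-∨-assoc iM bM iM = refl
  Em-∨-assoc iM iM oM = refl
  Em-∨-assoc iM iM aM = refl
  Em-∨-assoc iM iM bM = refl
  Em-∨-assoc iM iM iM = refl
  Em-∨-comm : ∀ x y → (x ∨Em y) ≡ (y ∨Em x)
  Em-∨-comm oM oM = refl
  Em-∨-comm oM aM = refl
  Em-∨-comm oM bM = refl
  Em-∨-comm oM iM = refl
  Em-∨-comm aM oM = refl
  Em-∨-comm aM aM = refl
  Em-∨-comm aM bM = refl
  Em-∨-comm aM iM = refl
  Em-∨-comm bM oM = refl
  Em-∨-comm bM aM = refl
  Em-∨-comm bM bM = refl
  Em-∨-comm bM iM = refl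
  Em-∨-comm iM oM = refl
  Em-∨-comm iM aM = refl
  Em-∨-comm iM bM = refl
  Em-∨-comm iM iM = refl
  Em-∧-assoc : ∀ x y z → ((x ∧Em y) ∧Em z) ≡ (x ∧Em (y ∧Em z))
  Em-∧-assoc oM oM oM = refl
  Em-∧-assoc oM oM aM = refl
  Em-∧-assoc oM oM bM = refl
  Em-∧-assoc oM oM iM = refl
  Em-∧-assoc oM aM oM = refl
  Em-∧-assoc oM aM aM = refl
  Em-∧-assoc oM aM bM = refl
  Em-∧-assoc oM aM iM = refl
  Em-∧-assoc oM bM oM = refl
  Em-∧-assoc oM bM aM = refl
  Em-∧-assoc oM bM bM = refl
  Em-∧-assoc oM bM iM = refl
  Em-∧-assoc oM iM oM = refl
  Em-∧-assoc oM iM aM = refl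
  Em-∧-assoc oM iM bM = refl
  Em-∧-assoc oM iM iM = refl
  Em-∧-assoc aM oM oM = refl
  Em-∧-assoc aM oM aM = refl
  Em-∧-assoc aM oM bM = refl
  Em-∧-assoc aM oM iM = refl
  Em-∧-assoc aM aM oM = refl
  Em-∧-assoc aM aM aM = refl
  Em-∧-assoc aM aM bM = refl
  Em-∧-assoc aM aM iM = refl
  Em-∧-assoc aM bM oM = refl
  Em-∧-assoc aM bM aM = refl
  Em-∧-assoc aM bM bM = refl
  Em-∧-assoc aM bM iM = refl
  Em-∧-assoc aM iM oM = refl
  Em-∧-assoc aM iM aM = refl
  Em-∧-assoc aM iM bM = refl
  Em-∧-assoc aM iM iM = refl
  Em-∧-assoc bM oM oM = refl
  Em-∧-assoc bM oM aM = refl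
  Em-∧-assoc bM oM bM = refl
  Em-∧-assoc bM oM iM = refl
  Em-∧-assoc bM aM oM = refl
  Em-∧-assoc bM aM aM = refl
  Em-∧-assoc bM aM bM = refl
  Em-∧-assoc bM aM iM = refl
  Em-∧-assoc bM bM oM = refl
  Em-∧-assoc bM bM aM = refl
  Em-∧-assoc bM bM bM = refl
  Em-∧-assoc bM bM iM = refl
  Em-∧-assoc bM iM oM = refl
  Em-∧-assoc bM iM aM = refl
  Em-∧-assoc bM iM bM = refl
  Em-∧-assoc bM iM iM = refl
  Em-∧-assoc iM oM oM = refl
  Em-∧-assoc iM oM aM = refl
  Em-∧-assoc iM oM bM = refl
  Em-∧-assoc iM oM iM = refl
  Em-∧-assoc iM aM oM = refl
  Em-∧-assoc iM aM aM = refl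
  Em-∧-assoc iM aM bM = refl
  Em-∧-assoc iM aM iM = refl
  Em-∧-assoc iM bM oM = refl
  Em-∧-assoc iM bM aM = refl
  Em-∧-assoc iM bM bM = refl
  Em-∧-assoc iM bM iM = refl
  Em-∧-assoc iM iM oM = refl
  Em-∧-assoc iM iM aM = refl
  Em-∧-assoc iM iM bM = refl
  Em-∧-assoc iM iM iM = refl
  Em-∧-comm : ∀ x y → (x ∧Em y) ≡ (y ∧Em x)
  Em-∧-comm oM oM = refl
  Em-∧-comm oM aM = refl
  Em-∧-comm oM bM = refl
  Em-∧-comm oM iM = refl
  Em-∧-comm aM oM = refl
  Em-∧-comm aM aM = refl
  Em-∧-comm aM bM = refl
  Em-∧-comm aM iM = refl
  Em-∧-comm bM oM = refl
  Em-∧-comm bM aM = refl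
  Em-∧-comm bM bM = refl
  Em-∧-comm bM iM = refl
  Em-∧-comm iM oM = refl
  Em-∧-comm iM aM = refl
  Em-∧-comm iM bM = refl
  Em-∧-comm iM iM = refl
  Em-∨-absorbs-∧ : ∀ x y → (x ∨Em (x ∧Em y)) ≡ x
  Em-∨-absorbs-∧ oM oM = refl
  Em-∨-absorbs-∧ oM aM = refl
  Em-∨-absorbs-∧ oM bM = refl
  Em-∨-absorbs-∧ oM iM = refl
  Em-∨-absorbs-∧ aM oM = refl
  Em-∨-absorbs-∧ aM aM = refl
  Em-∨-absorbs-∧ aM bM = refl
  Em-∨-absorbs-∧ aM iM = refl
  Em-∨-absorbs-∧ bM oM = refl
  Em-∨-absorbs-∧ bM aM = refl
  Em-∨-absorbs-∧ bM bM = refl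
  Em-∨-absorbs-∧ bM iM = refl
  Em-∨-absorbs-∧ iM oM = refl
  Em-∨-absorbs-∧ iM aM = refl
  Em-∨-absorbs-∧ iM bM = refl
  Em-∨-absorbs-∧ iM iM = refl
  Em-∧-absorbs-∨ : ∀ x y → (x ∧Em (x ∨Em y)) ≡ x
  Em-∧-absorbs-∨ oM oM = refl
  Em-∧-absorbs-∨ oM aM = refl
  Em-∧-absorbs-∨ oM bM = refl
  Em-∧-absorbs-∨ oM iM = refl
  Em-∧-absorbs-∨ aM oM = refl
  Em-∧-absorbs-∨ aM aM = refl
  Em-∧-absorbs-∨ aM bM = refl
  Em-∧-absorbs-∨ aM iM = refl
  Em-∧-absorbs-∨ bM oM = refl
  Em-∧-absorbs-∨ bM aM = refl
  Em-∧-absorbs-∨ bM bM = refl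
  Em-∧-absorbs-∨ bM iM = refl
  Em-∧-absorbs-∨ iM oM = refl
  Em-∧-absorbs-∨ iM aM = refl
  Em-∧-absorbs-∨ iM bM = refl
  Em-∧-absorbs-∨ iM iM = refl
  Em-∧-distrib-∨ : ∀ x y z → (x ∧Em (y ∨Em z)) ≡ ((x ∧Em y) ∨Em (x ∧Em z))
  Em-∧-distrib-∨ oM oM oM = refl
  Em-∧-distrib-∨ oM oM aM = refl
  Em-∧-distrib-∨ oM oM bM = refl
  Em-∧-distrib-∨ oM oM iM = refl
  Em-∧-distrib-∨ oM aM oM = refl
  Em-∧-distrib-∨ oM aM aM = refl
  Em-∧-distrib-∨ oM aM bM = refl
  Em-∧-distrib-∨ oM aM iM = refl
  Em-∧-distrib-∨ oM bM oM = refl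
  Em-∧-distrib-∨ oM bM aM = refl
  Em-∧-distrib-∨ oM bM bM = refl
  Em-∧-distrib-∨ oM bM iM = refl
  Em-∧-distrib-∨ oM iM oM = refl
  Em-∧-distrib-∨ oM iM aM = refl
  Em-∧-distrib-∨ oM iM bM = refl
  Em-∧-distrib-∨ oM iM iM = refl
  Em-∧-distrib-∨ aM oM oM = refl
  Em-∧-distrib-∨ aM oM aM = refl
  Em-∧-distrib-∨ aM oM bM = refl
  Em-∧-distrib-∨ aM oM iM = refl
  Em-∧-distrib-∨ aM aM oM = refl
  Em-∧-distrib-∨ aM aM aM = refl
  Em-∧-distrib-∨ aM aM bM = refl
  Em-∧-distrib-∨ aM aM iM = refl
  Em-∧-distrib-∨ aM bM oM = refl
  Em-∧-distrib-∨ aM bM aM = refl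
  Em-∧-distrib-∨ aM bM bM = refl
  Em-∧-distrib-∨ aM bM iM = refl
  Em-∧-distrib-∨ aM iM oM = refl
  Em-∧-distrib-∨ aM iM aM = refl
  Em-∧-distrib-∨ aM iM bM = refl
  Em-∧-distrib-∨ aM iM iM = refl
  Em-∧-distrib-∨ bM oM oM = refl
  Em-∧-distrib-∨ bM oM aM = refl
  Em-∧-distrib-∨ bM oM bM = refl
  Em-∧-distrib-∨ bM oM iM = refl
  Em-∧-distrib-∨ bM aM oM = refl
  Em-∧-distrib-∨ bM aM aM = refl
  Em-∧-distrib-∨ bM aM bM = refl
  Em-∧-distrib-∨ bM aM iM = refl
  Em-∧-distrib-∨ bM bM oM = refl
  Em-∧-distrib-∨ bM bM aM = refl
  Em-∧-distrib-∨ bM bM bM = refl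
  Em-∧-distrib-∨ bM bM iM = refl
  Em-∧-distrib-∨ bM iM oM = refl
  Em-∧-distrib-∨ bM iM aM = refl
  Em-∧-distrib-∨ bM iM bM = refl
  Em-∧-distrib-∨ bM iM iM = refl
  Em-∧-distrib-∨ iM oM oM = refl
  Em-∧-distrib-∨ iM oM aM = refl
  Em-∧-distrib-∨ iM oM bM = refl
  Em-∧-distrib-∨ iM oM iM = refl
  Em-∧-distrib-∨ iM aM oM = refl
  Em-∧-distrib-∨ iM aM aM = refl
  Em-∧-distrib-∨ iM aM bM = refl
  Em-∧-distrib-∨ iM aM iM = refl
  Em-∧-distrib-∨ iM bM oM = refl
  Em-∧-distrib-∨ iM bM aM = refl
  Em-∧-distrib-∨ iM bM bM = refl
  Em-∧-distrib-∨ iM bM iM = refl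
  Em-∧-distrib-∨ iM iM oM = refl
  Em-∧-distrib-∨ iM iM aM = refl
  Em-∧-distrib-∨ iM iM bM = refl
  Em-∧-distrib-∨ iM iM iM = refl
  Em-∨-identity : ∀ x → (x ∨Em oM) ≡ x
  Em-∨-identity oM = refl
  Em-∨-identity aM = refl
  Em-∨-identity bM = refl
  Em-∨-identity iM = refl
  Em-∧-identity : ∀ x → (x ∧Em iM) ≡ x
  Em-∧-identity oM = refl
  Em-∧-identity aM = refl
  Em-∧-identity bM = refl
  Em-∧-identity iM = refl
  Em-°-deMorgan : ∀ x y → (°Em (x ∧Em y)) ≡ ((°Em x) ∨Em (°Em y))
  Em-°-deMorgan oM oM = refl
  Em-°-deMorgan oM aM = refl
  Em-°-deMorgan oM bM = refl
  Em-°-deMorgan oM iM = refl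
  Em-°-deMorgan aM oM = refl
  Em-°-deMorgan aM aM = refl
  Em-°-deMorgan aM bM = refl
  Em-°-deMorgan aM iM = refl
  Em-°-deMorgan bM oM = refl
  Em-°-deMorgan bM aM = refl
  Em-°-deMorgan bM bM = refl
  Em-°-deMorgan bM iM = refl
  Em-°-deMorgan iM oM = refl
  Em-°-deMorgan iM aM = refl
  Em-°-deMorgan iM bM = refl
  Em-°-deMorgan iM iM = refl
  Em-°-1 : (°Em iM) ≡ oM
  Em-°-1  = refl
  Em-°-involutive : ∀ x → (°Em (°Em x)) ≡ x
  Em-°-involutive oM = refl
  Em-°-involutive aM = refl
  Em-°-involutive bM = refl
  Em-°-involutive iM = refl

Em : DeMorgan
Em = record { ops = opsEm ; isDeMorgan = isDMEm }


data Factor : Set where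
  two three m₁ : Factor

⟦_⟧ : Factor → DeMorgan
⟦ two ⟧   = Two
⟦ three ⟧ = Three
⟦ m₁ ⟧    = Em

∏ : List Factor → DeMorgan
∏ []       = Unit
∏ (c ∷ cs) = ⟦ c ⟧ ⊗ ∏ cs

module Submission where

-- The proof goes through an intrinsic property of M, called here
-- "Boolean witnessing": whenever a congruence Ψ identifies x and y, there
-- is a Boolean f with f Ψ 1 and x ∧ f = y ∧ f.  Every congruence θ of
-- B(M) has a canonical extension Φθ (x Φθ y iff such an f with f θ 1
-- exists), and M is a perfect extension of B(M) exactly when M is
-- Boolean witnessed, i.e. when every congruence equals the canonical
-- extension of its restriction.
--
-- Boolean witnessing holds for the simple algebras 2, 3, M₁, is preserved
-- by products and by split surjective homomorphisms; this gives "⇐".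
-- For "⇒", a Boolean e ∉ {0,1} splits M ≅ ↓e × ↓e° into strictly smaller
-- Boolean-witnessed algebras, so by induction on the size it remains to
-- treat a Boolean-witnessed M with B(M) = {0,1}: there every element
-- besides 0 and 1 is a fixed point of °, two distinct such elements are
-- complements of each other, and hence M is trivial, 2, 3 or M₁.

open import Defs
open import Data.List using (List; []; _∷_; _++_; length; filter; map; allFin)
open import Data.List.Relation.Unary.Any using (Any; here; there; any?; satisfied)
open import Data.List.Membership.Propositional using (_∈_; lose)
open import Data.List.Membership.Propositional.Properties using (∈-map⁺; ∈-filter⁺; ∈-allFin)
open import Data.List.Properties using (length-map; filter-notAll)
open import Data.Nat using (zero; suc; _≤_; _<_)
open import Data.Nat.Properties using (≤-refl; ≤-pred; <-≤-trans)
open import Data.Fin using () renaming (_≟_ to _≟ᶠ_)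
open import Data.Unit using (tt)
open import Data.Empty using (⊥-elim)
open import Data.Sum using (_⊎_; inj₁; inj₂)
open import Data.Product using (Σ; ∃; _×_; _,_; proj₁; proj₂; map₂)
open import Function.Bundles using (_⇔_; mk⇔; Equivalence; Inverse)
open import Relation.Nullary using (¬_; Dec; yes; no; ¬?; _×-dec_)
open import Relation.Binary.Definitions using (DecidableEquality)
open import Relation.Binary.Structures using (IsEquivalence)
open import Relation.Binary.PropositionalEquality
  using (_≡_; _≢_; refl; cong; cong₂; sym; trans; subst; module ≡-Reasoning)
open import Axiom.UniquenessOfIdentityProofs using (module Decidable⇒UIP)

module Laws (M : DeMorgan) where
  open DeMorgan M

  ∧-idem : ∀ x → (x ∧ x) ≡ x
  ∧-idem x = trans (cong (x ∧_) (sym (∨-absorbs-∧ x x))) (∧-absorbs-∨ x (x ∧ x))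

  ∨-idem : ∀ x → (x ∨ x) ≡ x
  ∨-idem x = trans (cong (x ∨_) (sym (∧-absorbs-∨ x x))) (∨-absorbs-∧ x (x ∨ x))

  ∨-identityˡ : ∀ x → (0# ∨ x) ≡ x
  ∨-identityˡ x = trans (∨-comm 0# x) (∨-identity x)

  ∧-identityˡ : ∀ x → (1# ∧ x) ≡ x
  ∧-identityˡ x = trans (∧-comm 1# x) (∧-identity x)

  ∧-zeroˡ : ∀ x → (0# ∧ x) ≡ 0#
  ∧-zeroˡ x = trans (cong (0# ∧_) (sym (∨-identityˡ x))) (∧-absorbs-∨ 0# x)

  ∧-zeroʳ : ∀ x → (x ∧ 0#) ≡ 0#
  ∧-zeroʳ x = trans (∧-comm x 0#) (∧-zeroˡ x)

  ∨-zeroˡ : ∀ x → (1# ∨ x) ≡ 1#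
  ∨-zeroˡ x = trans (cong (1# ∨_) (sym (∧-identityˡ x))) (∨-absorbs-∧ 1# x)

  ∨-zeroʳ : ∀ x → (x ∨ 1#) ≡ 1#
  ∨-zeroʳ x = trans (∨-comm x 1#) (∨-zeroˡ x)

  ∧-absorbˡ : ∀ x y → (x ∧ (x ∧ y)) ≡ (x ∧ y)
  ∧-absorbˡ x y = trans (sym (∧-assoc x x y)) (cong (_∧ y) (∧-idem x))

  ∨-absorbˡ : ∀ x y → (x ∨ (x ∨ y)) ≡ (x ∨ y)
  ∨-absorbˡ x y = trans (sym (∨-assoc x x y)) (cong (_∨ y) (∨-idem x))

  ∧-distribʳ : ∀ x y z → ((y ∨ z) ∧ x) ≡ ((y ∧ x) ∨ (z ∧ x))
  ∧-distribʳ x y z = trans (∧-comm (y ∨ z) x)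
    (trans (∧-distrib-∨ x y z) (cong₂ _∨_ (∧-comm x y) (∧-comm x z)))

  ∨-distrib-∧ : ∀ x y z → (x ∨ (y ∧ z)) ≡ ((x ∨ y) ∧ (x ∨ z))
  ∨-distrib-∧ x y z = sym (begin
      (x ∨ y) ∧ (x ∨ z)              ≡⟨ ∧-distrib-∨ (x ∨ y) x z ⟩
      ((x ∨ y) ∧ x) ∨ ((x ∨ y) ∧ z)  ≡⟨ cong₂ _∨_ (trans (∧-comm (x ∨ y) x) (∧-absorbs-∨ x y))
                                                  (∧-comm (x ∨ y) z) ⟩
      x ∨ (z ∧ (x ∨ y))              ≡⟨ cong (x ∨_) (∧-distrib-∨ z x y) ⟩
      x ∨ ((z ∧ x) ∨ (z ∧ y))        ≡⟨ sym (∨-assoc x (z ∧ x) (z ∧ y)) ⟩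
      (x ∨ (z ∧ x)) ∨ (z ∧ y)        ≡⟨ cong₂ _∨_ (trans (cong (x ∨_) (∧-comm z x)) (∨-absorbs-∧ x z))
                                                  (∧-comm z y) ⟩
      x ∨ (y ∧ z)                    ∎)
    where open ≡-Reasoning

  ∨-distribʳ : ∀ x y z → ((y ∧ z) ∨ x) ≡ ((y ∨ x) ∧ (z ∨ x))
  ∨-distribʳ x y z = trans (∨-comm (y ∧ z) x)
    (trans (∨-distrib-∧ x y z) (cong₂ _∧_ (∨-comm x y) (∨-comm x z)))

  ∧-rearr : ∀ x u f g → ((x ∧ u) ∧ (f ∧ g)) ≡ ((x ∧ f) ∧ (u ∧ g))
  ∧-rearr x u f g = begin
      (x ∧ u) ∧ (f ∧ g)  ≡⟨ ∧-assoc x u (f ∧ g) ⟩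
      x ∧ (u ∧ (f ∧ g))  ≡⟨ cong (x ∧_) (sym (∧-assoc u f g)) ⟩
      x ∧ ((u ∧ f) ∧ g)  ≡⟨ cong (λ t → x ∧ (t ∧ g)) (∧-comm u f) ⟩
      x ∧ ((f ∧ u) ∧ g)  ≡⟨ cong (x ∧_) (∧-assoc f u g) ⟩
      x ∧ (f ∧ (u ∧ g))  ≡⟨ sym (∧-assoc x f (u ∧ g)) ⟩
      (x ∧ f) ∧ (u ∧ g)  ∎
    where open ≡-Reasoning

  ∨-rearr : ∀ x u f g → ((x ∨ u) ∨ (f ∨ g)) ≡ ((x ∨ f) ∨ (u ∨ g))
  ∨-rearr x u f g = begin
      (x ∨ u) ∨ (f ∨ g)  ≡⟨ ∨-assoc x u (f ∨ g) ⟩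
      x ∨ (u ∨ (f ∨ g))  ≡⟨ cong (x ∨_) (sym (∨-assoc u f g)) ⟩
      x ∨ ((u ∨ f) ∨ g)  ≡⟨ cong (λ t → x ∨ (t ∨ g)) (∨-comm u f) ⟩
      x ∨ ((f ∨ u) ∨ g)  ≡⟨ cong (x ∨_) (∨-assoc f u g) ⟩
      x ∨ (f ∨ (u ∨ g))  ≡⟨ sym (∨-assoc x f (u ∨ g)) ⟩
      (x ∨ f) ∨ (u ∨ g)  ∎
    where open ≡-Reasoning

  ∧-dup : ∀ x u d → ((x ∧ u) ∧ d) ≡ ((x ∧ d) ∧ (u ∧ d))
  ∧-dup x u d = trans (cong ((x ∧ u) ∧_) (sym (∧-idem d))) (∧-rearr x u d d)

  ∨-dup : ∀ x u d → ((x ∨ u) ∨ d) ≡ ((x ∨ d) ∨ (u ∨ d))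
  ∨-dup x u d = trans (cong ((x ∨ u) ∨_) (sym (∨-idem d))) (∨-rearr x u d d)

  °-0 : (0# °) ≡ 1#
  °-0 = trans (cong _° (sym °-1)) (°-involutive 1#)

  °-∨ : ∀ x y → ((x ∨ y) °) ≡ ((x °) ∧ (y °))
  °-∨ x y =
    trans (cong _° (cong₂ _∨_ (sym (°-involutive x)) (sym (°-involutive y))))
    (trans (cong _° (sym (°-deMorgan (x °) (y °)))) (°-involutive ((x °) ∧ (y °))))

  complˡ : ∀ x → (x ∨ (x °)) ≡ 1# → ((x °) ∧ x) ≡ 0#
  complˡ x p = trans (cong ((x °) ∧_) (sym (°-involutive x)))
    (trans (sym (°-∨ x (x °))) (trans (cong _° p) °-1))

  complʳ : ∀ x → (x ∨ (x °)) ≡ 1# → (x ∧ (x °)) ≡ 0#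
  complʳ x p = trans (∧-comm x (x °)) (complˡ x p)

  compl-unique : ∀ {a b c} → (a ∧ b) ≡ 0# → (a ∨ b) ≡ 1# → (a ∧ c) ≡ 0# → (a ∨ c) ≡ 1# → b ≡ c
  compl-unique {a} {b} {c} ab0 ab1 ac0 ac1 =
    trans (below b c ac1 ab0) (sym (trans (below c b ab1 ac0) (∧-comm c b)))
    where
    below : ∀ u v → (a ∨ v) ≡ 1# → (a ∧ u) ≡ 0# → u ≡ (u ∧ v)
    below u v av1 au0 = begin
      u                  ≡⟨ sym (∧-identity u) ⟩
      u ∧ 1#             ≡⟨ cong (u ∧_) (sym av1) ⟩
      u ∧ (a ∨ v)        ≡⟨ ∧-distrib-∨ u a v ⟩
      (u ∧ a) ∨ (u ∧ v)  ≡⟨ cong (_∨ (u ∧ v)) (trans (∧-comm u a) au0) ⟩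
      0# ∨ (u ∧ v)       ≡⟨ ∨-identityˡ _ ⟩
      u ∧ v              ∎
      where open ≡-Reasoning

  °-meet : ∀ x f → (f ∨ (f °)) ≡ 1# → (((x ∧ f) °) ∧ f) ≡ ((x °) ∧ f)
  °-meet x f p = begin
      ((x ∧ f) °) ∧ f            ≡⟨ cong (_∧ f) (°-deMorgan x f) ⟩
      ((x °) ∨ (f °)) ∧ f        ≡⟨ ∧-distribʳ f (x °) (f °) ⟩
      ((x °) ∧ f) ∨ ((f °) ∧ f)  ≡⟨ cong (((x °) ∧ f) ∨_) (complˡ f p) ⟩
      ((x °) ∧ f) ∨ 0#           ≡⟨ ∨-identity _ ⟩
      (x °) ∧ f                  ∎
    where open ≡-Reasoning

cresp : ∀ {A : DMOps} (Ψ : Congruence A) {u u' v v'} → u ≡ u' → v ≡ v' →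
        Congruence._≈_ Ψ u v → Congruence._≈_ Ψ u' v'
cresp Ψ refl refl t = t

pullback : ∀ {M N} (h : DeMorgan.Carrier M → DeMorgan.Carrier N) → IsHomomorphism M N h →
           Congruence (DeMorgan.ops N) → Congruence (DeMorgan.ops M)
pullback h hom Ψ = record
  { _≈_ = λ x y → h x ≋ h y
  ; isEquiv = record { refl = IsEquivalence.refl isEquiv
                     ; sym = IsEquivalence.sym isEquiv
                     ; trans = IsEquivalence.trans isEquiv }
  ; ∨-cong = λ r s → cresp Ψ (sym (∨-homo _ _)) (sym (∨-homo _ _)) (∨-cong r s)
  ; ∧-cong = λ r s → cresp Ψ (sym (∧-homo _ _)) (sym (∧-homo _ _)) (∧-cong r s)
  ; °-cong = λ r → cresp Ψ (sym (°-homo _)) (sym (°-homo _)) (°-cong r) }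
  where
  open IsHomomorphism hom
  open Congruence Ψ renaming (_≈_ to _≋_)

-- Isomorphisms with an explicit inverse; equivalent to the bijective
-- homomorphisms _≅_ of the statement, but easier to compose.
record Iso (M N : DeMorgan) : Set where
  private
    module M = DeMorgan M
    module N = DeMorgan N
  field
    to      : M.Carrier → N.Carrier
    from    : N.Carrier → M.Carrier
    to-from : ∀ y → to (from y) ≡ y
    from-to : ∀ x → from (to x) ≡ x
    hom     : IsHomomorphism M N to

  from-hom : IsHomomorphism N M from
  from-hom = record
    { ∨-homo = λ u v → preserves₂ M._∨_ N._∨_ ∨-homo u v
    ; ∧-homo = λ u v → preserves₂ M._∧_ N._∧_ ∧-homo u v
    ; °-homo = λ u → trans (cong (λ t → from (t N.°)) (sym (to-from u)))
                (trans (cong from (sym (°-homo (from u)))) (from-to _))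
    ; 0-homo = trans (cong from (sym 0-homo)) (from-to _)
    ; 1-homo = trans (cong from (sym 1-homo)) (from-to _)
    }
    where
    open IsHomomorphism hom
    preserves₂ : ∀ (_•_ : M.Carrier → M.Carrier → M.Carrier) (_◦_ : N.Carrier → N.Carrier → N.Carrier) →
                 (∀ x y → to (x • y) ≡ (to x ◦ to y)) → ∀ u v → from (u ◦ v) ≡ (from u • from v)
    preserves₂ _•_ _◦_ homo u v = begin
      from (u ◦ v)                     ≡⟨ cong₂ (λ s t → from (s ◦ t)) (sym (to-from u)) (sym (to-from v)) ⟩
      from (to (from u) ◦ to (from v)) ≡⟨ cong from (sym (homo (from u) (from v))) ⟩
      from (to (from u • from v))      ≡⟨ from-to _ ⟩
      from u • from v                  ∎
      where open ≡-Reasoning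

mkIso : ∀ {X M} (g : DeMorgan.Carrier X → DeMorgan.Carrier M) → IsHomomorphism X M g →
        (s : DeMorgan.Carrier M → DeMorgan.Carrier X) → (∀ x → g (s x) ≡ x) →
        (∀ {y y'} → g y ≡ g y' → y ≡ y') → Iso X M
mkIso g h s gs inj = record { to = g ; from = s ; to-from = gs ; from-to = λ y → inj (gs (g y)) ; hom = h }

Iso→≅ : ∀ {M N} → Iso M N → M ≅ N
Iso→≅ i = to , hom , (λ {x} {y} e → trans (sym (from-to x)) (trans (cong from e) (from-to y))) ,
          (λ y → from y , λ { refl → to-from y })
  where open Iso i

≅→Iso : ∀ {M N} → M ≅ N → Iso M N
≅→Iso (f , h , inj , surj) = record
  { to = f ; from = λ y → proj₁ (surj y)
  ; to-from = λ y → proj₂ (surj y) refl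
  ; from-to = λ x → inj (proj₂ (surj (f x)) refl)
  ; hom = h }

module _ where
  open IsHomomorphism

  Iso-refl : ∀ {M} → Iso M M
  Iso-refl = record { to = λ x → x ; from = λ x → x ; to-from = λ _ → refl ; from-to = λ _ → refl
    ; hom = record { ∨-homo = λ _ _ → refl ; ∧-homo = λ _ _ → refl ; °-homo = λ _ → refl
                   ; 0-homo = refl ; 1-homo = refl } }

  Iso-assoc : ∀ {A B C} → Iso (A ⊗ (B ⊗ C)) ((A ⊗ B) ⊗ C)
  Iso-assoc = record
    { to = λ { (a , (b , c)) → ((a , b) , c) }
    ; from = λ { ((a , b) , c) → (a , (b , c)) }
    ; to-from = λ _ → refl ; from-to = λ _ → refl
    ; hom = record { ∨-homo = λ _ _ → refl ; ∧-homo = λ _ _ → refl ; °-homo = λ _ → refl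
                   ; 0-homo = refl ; 1-homo = refl } }

  Iso-unitˡ : ∀ {A} → Iso A (Unit ⊗ A)
  Iso-unitˡ = record
    { to = λ a → tt , a ; from = proj₂
    ; to-from = λ _ → refl ; from-to = λ _ → refl
    ; hom = record { ∨-homo = λ _ _ → refl ; ∧-homo = λ _ _ → refl ; °-homo = λ _ → refl
                   ; 0-homo = refl ; 1-homo = refl } }

  Iso-unitʳ : ∀ {A} → Iso (A ⊗ Unit) A
  Iso-unitʳ = record
    { to = proj₁ ; from = λ a → a , tt
    ; to-from = λ _ → refl ; from-to = λ _ → refl
    ; hom = record { ∨-homo = λ _ _ → refl ; ∧-homo = λ _ _ → refl ; °-homo = λ _ → refl
                   ; 0-homo = refl ; 1-homo = refl } }

  Iso-sym : ∀ {M N} → Iso M N → Iso N M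
  Iso-sym i = record { to = from ; from = to ; to-from = from-to ; from-to = to-from ; hom = from-hom }
    where open Iso i

  Iso-trans : ∀ {M N K} → Iso M N → Iso N K → Iso M K
  Iso-trans i j = record
    { to = λ x → J.to (I.to x)
    ; from = λ z → I.from (J.from z)
    ; to-from = λ z → trans (cong J.to (I.to-from (J.from z))) (J.to-from z)
    ; from-to = λ x → trans (cong I.from (J.from-to (I.to x))) (I.from-to x)
    ; hom = record
      { ∨-homo = λ x y → trans (cong J.to (∨-homo I.hom x y)) (∨-homo J.hom _ _)
      ; ∧-homo = λ x y → trans (cong J.to (∧-homo I.hom x y)) (∧-homo J.hom _ _)
      ; °-homo = λ x → trans (cong J.to (°-homo I.hom x)) (°-homo J.hom _)
      ; 0-homo = trans (cong J.to (0-homo I.hom)) (0-homo J.hom)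
      ; 1-homo = trans (cong J.to (1-homo I.hom)) (1-homo J.hom) } }
    where
    module I = Iso i
    module J = Iso j

  Iso-⊗ : ∀ {A A' C C'} → Iso A A' → Iso C C' → Iso (A ⊗ C) (A' ⊗ C')
  Iso-⊗ i j = record
    { to = λ { (a , c) → I.to a , J.to c }
    ; from = λ { (a , c) → I.from a , J.from c }
    ; to-from = λ { (a , c) → cong₂ _,_ (I.to-from a) (J.to-from c) }
    ; from-to = λ { (a , c) → cong₂ _,_ (I.from-to a) (J.from-to c) }
    ; hom = record
      { ∨-homo = λ { (a , c) (a' , c') → cong₂ _,_ (∨-homo I.hom a a') (∨-homo J.hom c c') }
      ; ∧-homo = λ { (a , c) (a' , c') → cong₂ _,_ (∧-homo I.hom a a') (∧-homo J.hom c c') }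
      ; °-homo = λ { (a , c) → cong₂ _,_ (°-homo I.hom a) (°-homo J.hom c) }
      ; 0-homo = cong₂ _,_ (0-homo I.hom) (0-homo J.hom)
      ; 1-homo = cong₂ _,_ (1-homo I.hom) (1-homo J.hom) } }
    where
    module I = Iso i
    module J = Iso j

Iso-++ : ∀ cs ds → Iso (∏ (cs ++ ds)) (∏ cs ⊗ ∏ ds)
Iso-++ [] ds = Iso-unitˡ
Iso-++ (c ∷ cs) ds =
  Iso-trans (Iso-⊗ (Iso-refl {⟦ c ⟧}) (Iso-++ cs ds)) (Iso-assoc {⟦ c ⟧} {∏ cs} {∏ ds})

BooleanWitnessed : DeMorgan → Set₁
BooleanWitnessed M = ∀ (Ψ : Congruence ops) x y → Congruence._≈_ Ψ x y →
  Σ Carrier λ f → InB f × Congruence._≈_ Ψ f 1# × ((x ∧ f) ≡ (y ∧ f))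
  where open DeMorgan M
        open Skeleton M

-- Elements of B(M) are
-- pairs, so we need proofs of membership in B(M) to be unique.
module CanonicalExtension (M : DeMorgan) (uip : ∀ {x} (p q : Skeleton.InB M x) → p ≡ q) where
  open DeMorgan M
  open Skeleton M
  open Laws M

  BC : Set
  BC = Σ Carrier InB

  B-≡ : ∀ {u v : BC} → proj₁ u ≡ proj₁ v → u ≡ v
  B-≡ {x , p} {.x , q} refl = cong (x ,_) (uip p q)

  1B : BC
  1B = 1# , 1∈B

  restrict : Congruence ops → Congruence B
  restrict Ψ = record
    { _≈_ = λ u v → proj₁ u ≋ proj₁ v
    ; isEquiv = record { refl = IsEquivalence.refl isEquiv
                       ; sym = IsEquivalence.sym isEquiv
                       ; trans = IsEquivalence.trans isEquiv }
    ; ∨-cong = ∨-cong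
    ; ∧-cong = ∧-cong
    ; °-cong = °-cong }
    where open Congruence Ψ renaming (_≈_ to _≋_)

  module _ (θ : Congruence B) where
    open Congruence θ renaming (_≈_ to _~_)
    private module E = IsEquivalence isEquiv

    resp : ∀ {u u' v v'} → u ≡ u' → v ≡ v' → u ~ v → u' ~ v'
    resp refl refl t = t

    Φrel : Carrier → Carrier → Set
    Φrel x y = Σ Carrier λ f → Σ (InB f) λ p → ((f , p) ~ 1B) × ((x ∧ f) ≡ (y ∧ f))

    meet-witness : ∀ {f g} {p : InB f} {q : InB g} → (f , p) ~ 1B → (g , q) ~ 1B →
                   ((f ∧ g) , ∧∈B p q) ~ 1B
    meet-witness t s = resp refl (B-≡ (∧-idem 1#)) (∧-cong t s)

    agree-below-meetˡ : ∀ {x y f} → (x ∧ f) ≡ (y ∧ f) → ∀ g → (x ∧ (f ∧ g)) ≡ (y ∧ (f ∧ g))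
    agree-below-meetˡ {x} {y} {f} e g =
      trans (sym (∧-assoc x f g)) (trans (cong (_∧ g) e) (∧-assoc y f g))

    agree-below-meetʳ : ∀ {x y g} → (x ∧ g) ≡ (y ∧ g) → ∀ f → (x ∧ (f ∧ g)) ≡ (y ∧ (f ∧ g))
    agree-below-meetʳ {x} {y} {g} e f = trans (cong (x ∧_) (∧-comm f g))
      (trans (agree-below-meetˡ e f) (cong (y ∧_) (∧-comm g f)))

    Φθ : Congruence ops
    Φθ = record
      { _≈_ = Φrel
      ; isEquiv = record
         { refl = λ {x} → 1# , 1∈B , E.refl , refl
         ; sym = λ { (f , p , t , e) → f , p , t , sym e }
         ; trans = λ { (f , p , t , e) (g , q , s , d) →
             (f ∧ g) , ∧∈B p q , meet-witness t s ,
             trans (agree-below-meetˡ e g) (agree-below-meetʳ d f) } }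
      ; ∨-cong = λ { {x} {y} {u} {v} (f , p , t , e) (g , q , s , d) →
          (f ∧ g) , ∧∈B p q , meet-witness t s ,
          trans (∧-distribʳ (f ∧ g) x u)
            (trans (cong₂ _∨_ (agree-below-meetˡ e g) (agree-below-meetʳ d f))
                   (sym (∧-distribʳ (f ∧ g) y v))) }
      ; ∧-cong = λ { {x} {y} {u} {v} (f , p , t , e) (g , q , s , d) →
          (f ∧ g) , ∧∈B p q , meet-witness t s ,
          trans (∧-rearr x u f g) (trans (cong₂ _∧_ e d) (sym (∧-rearr y v f g))) }
      ; °-cong = λ { {x} {y} (f , p , t , e) →
          f , p , t , trans (sym (°-meet x f p)) (trans (cong (λ z → (z °) ∧ f) e) (°-meet y f p)) }
      }

    -- Φθ restricts to θ on B(M).  For Boolean a θ b, the Boolean element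
    -- (a ∧ b) ∨ (a ∨ b)° is θ-related to 1 and a, b agree below it.
    Φθ-extends : Extends θ Φθ
    Φθ-extends (a , pa) (b , pb) = mk⇔ to from
      where
      w : Carrier
      w = (a ∧ b) ∨ ((a ∨ b) °)
      pw : InB w
      pw = ∨∈B (∧∈B pa pb) (°∈B (∨∈B pa pb))
      below : ∀ c d → InB c → (c ∧ ((c ∧ d) ∨ ((c ∨ d) °))) ≡ (c ∧ d)
      below c d p = begin
        c ∧ ((c ∧ d) ∨ ((c ∨ d) °))          ≡⟨ ∧-distrib-∨ c (c ∧ d) ((c ∨ d) °) ⟩
        (c ∧ (c ∧ d)) ∨ (c ∧ ((c ∨ d) °))    ≡⟨ cong₂ _∨_ (∧-absorbˡ c d) (cong (c ∧_) (°-∨ c d)) ⟩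
        (c ∧ d) ∨ (c ∧ ((c °) ∧ (d °)))      ≡⟨ cong ((c ∧ d) ∨_) (sym (∧-assoc c (c °) (d °))) ⟩
        (c ∧ d) ∨ ((c ∧ (c °)) ∧ (d °))      ≡⟨ cong (λ z → (c ∧ d) ∨ (z ∧ (d °))) (complʳ c p) ⟩
        (c ∧ d) ∨ (0# ∧ (d °))               ≡⟨ cong ((c ∧ d) ∨_) (∧-zeroˡ (d °)) ⟩
        (c ∧ d) ∨ 0#                         ≡⟨ ∨-identity (c ∧ d) ⟩
        c ∧ d                                ∎
        where open ≡-Reasoning
      a-below-w : (a ∧ w) ≡ (a ∧ b)
      a-below-w = below a b pa
      b-below-w : (b ∧ w) ≡ (a ∧ b)
      b-below-w = trans (cong₂ (λ s t → b ∧ (s ∨ (t °))) (∧-comm a b) (∨-comm a b))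
                        (trans (below b a pb) (∧-comm b a))
      to : (a , pa) ~ (b , pb) → Φrel a b
      to t = w , pw , w~1 , trans a-below-w (sym b-below-w)
        where
        ab~a : ((a ∧ b) , ∧∈B pa pb) ~ (a , pa)
        ab~a = E.sym (resp (B-≡ (∧-idem a)) refl (∧-cong (E.refl {a , pa}) t))
        a~a∨b : (a , pa) ~ ((a ∨ b) , ∨∈B pa pb)
        a~a∨b = resp (B-≡ (∨-idem a)) refl (∨-cong (E.refl {a , pa}) t)
        w~1 : (w , pw) ~ 1B
        w~1 = resp (B-≡ refl) (B-≡ (∨∈B pa pb))
                   (∨-cong (E.trans ab~a a~a∨b) (E.refl {((a ∨ b) °) , °∈B (∨∈B pa pb)}))
      from : Φrel a b → (a , pa) ~ (b , pb)
      from (f , p , t , e) =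
        E.trans (E.sym (meet-f a pa)) (E.trans (resp refl (B-≡ e) E.refl) (meet-f b pb))
        where
        meet-f : ∀ c (pc : InB c) → ((c ∧ f) , ∧∈B pc p) ~ (c , pc)
        meet-f c pc = resp refl (B-≡ (∧-identity c)) (∧-cong (E.refl {c , pc}) t)

  -- Any extension Ψ of θ contains Φθ; it equals Φθ if M is Boolean witnessed.
  witnessed⇒perfect : BooleanWitnessed M → PerfectExtensionOfSkeleton M
  witnessed⇒perfect witnessed θ = Φθ θ , Φθ-extends θ , unique
    where
    unique : ∀ (Ψ : Congruence ops) → Extends θ Ψ → SameCongruence (Φθ θ) Ψ
    unique Ψ ext x y = mk⇔ to from
      where
      open Congruence Ψ renaming (_≈_ to _≋_)
      module F = IsEquivalence isEquiv
      to : Φrel θ x y → x ≋ y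
      to (f , p , t , e) = F.trans (meet-f x) (F.trans (cresp Ψ refl e F.refl) (F.sym (meet-f y)))
        where
        meet-f : ∀ c → c ≋ (c ∧ f)
        meet-f c = cresp Ψ (∧-identity c) refl
                     (∧-cong (F.refl {c}) (F.sym (Equivalence.to (ext (f , p) 1B) t)))
      from : x ≋ y → Φrel θ x y
      from r with witnessed Ψ x y r
      ... | f , p , s , e = f , p , Equivalence.from (ext (f , p) 1B) s , e

  -- Every congruence Ψ extends its restriction, as does the canonical
  -- extension of that restriction; uniqueness identifies them.
  perfect⇒witnessed : PerfectExtensionOfSkeleton M → BooleanWitnessed M
  perfect⇒witnessed perfect Ψ x y r =
    Equivalence.to (unique (Φθ θ) (Φθ-extends θ) x y)
                   (Equivalence.from (unique Ψ (λ u v → mk⇔ (λ z → z) (λ z → z)) x y) r)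
    where
    θ = restrict Ψ
    unique = proj₂ (proj₂ (perfect θ))

-- Boolean witnessing passes to the codomain of a homomorphism h with a
-- right inverse s: pull the congruence back along h, witness there, and
-- push the witness forward.
witnessed-image : ∀ {M N} (h : DeMorgan.Carrier M → DeMorgan.Carrier N) → IsHomomorphism M N h →
                  (s : DeMorgan.Carrier N → DeMorgan.Carrier M) → (∀ y → h (s y) ≡ y) →
                  BooleanWitnessed M → BooleanWitnessed N
witnessed-image {M} {N} h hom s hs witnessed Ψ u v r
  with witnessed (pullback h hom Ψ) (s u) (s v) (cresp Ψ (sym (hs u)) (sym (hs v)) r)
... | f , p , t , e = h f , h-Boolean , cresp Ψ refl 1-homo t , agree
  where
  module M = DeMorgan M
  module N = DeMorgan N
  open IsHomomorphism hom
  h-Boolean : (h f N.∨ (h f N.°)) ≡ N.1#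
  h-Boolean = trans (sym (trans (∨-homo f (f M.°)) (cong (h f N.∨_) (°-homo f))))
                    (trans (cong h p) 1-homo)
  agree : (u N.∧ h f) ≡ (v N.∧ h f)
  agree = begin
    u N.∧ h f        ≡⟨ cong (N._∧ h f) (sym (hs u)) ⟩
    h (s u) N.∧ h f  ≡⟨ sym (∧-homo (s u) f) ⟩
    h (s u M.∧ f)    ≡⟨ cong h e ⟩
    h (s v M.∧ f)    ≡⟨ ∧-homo (s v) f ⟩
    h (s v) N.∧ h f  ≡⟨ cong (N._∧ h f) (hs v) ⟩
    v N.∧ h f        ∎
    where open ≡-Reasoning

witnessed-iso : ∀ {M N} → Iso M N → BooleanWitnessed N → BooleanWitnessed M
witnessed-iso i = witnessed-image from from-hom to from-to
  where open Iso i

-- In an algebra where every congruence is trivial or identifies 0 with 1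
-- (a simple algebra), 1 resp. 0 serves as witness.
module _ (M : DeMorgan) where
  open DeMorgan M
  open Skeleton M
  open Laws M

  witnessed-simple : (∀ (Ψ : Congruence ops) x y →
                        Congruence._≈_ Ψ x y → x ≡ y ⊎ Congruence._≈_ Ψ 0# 1#) →
                     BooleanWitnessed M
  witnessed-simple simple Ψ x y r with simple Ψ x y r
  ... | inj₁ e = 1# , 1∈B , IsEquivalence.refl (Congruence.isEquiv Ψ) , cong (_∧ 1#) e
  ... | inj₂ s = 0# , 0∈B , s , trans (∧-zeroʳ x) (sym (∧-zeroʳ y))

witnessed-Unit : BooleanWitnessed Unit
witnessed-Unit Ψ x y r = tt , refl , IsEquivalence.refl (Congruence.isEquiv Ψ) , refl

witnessed-Two : BooleanWitnessed Two
witnessed-Two = witnessed-simple Two simple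
  where
  simple : ∀ (Ψ : Congruence opsTwo) x y → Congruence._≈_ Ψ x y → x ≡ y ⊎ Congruence._≈_ Ψ o2 i2
  simple Ψ o2 o2 r = inj₁ refl
  simple Ψ o2 i2 r = inj₂ r
  simple Ψ i2 o2 r = inj₂ (IsEquivalence.sym (Congruence.isEquiv Ψ) r)
  simple Ψ i2 i2 r = inj₁ refl

-- In 3, a fixed point a with 0 Ψ a gives 0 Ψ a = a° Ψ 0° = 1.
witnessed-Three : BooleanWitnessed Three
witnessed-Three = witnessed-simple Three simple
  where
  simple : ∀ (Ψ : Congruence opsThree) x y → Congruence._≈_ Ψ x y → x ≡ y ⊎ Congruence._≈_ Ψ o3 i3
  simple Ψ = go
    where
    open Congruence Ψ
    open IsEquivalence isEquiv renaming (refl to ≈refl; sym to ≈sym; trans to ≈trans)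
    o~a : o3 ≈ a3 → o3 ≈ i3
    o~a r = ≈trans r (≈sym (°-cong r))
    go : ∀ x y → x ≈ y → x ≡ y ⊎ o3 ≈ i3
    go o3 o3 r = inj₁ refl
    go o3 a3 r = inj₂ (o~a r)
    go o3 i3 r = inj₂ r
    go a3 o3 r = inj₂ (o~a (≈sym r))
    go a3 a3 r = inj₁ refl
    go a3 i3 r = inj₂ (o~a (≈sym (°-cong r)))
    go i3 o3 r = inj₂ (≈sym r)
    go i3 a3 r = inj₂ (o~a (°-cong r))
    go i3 i3 r = inj₁ refl

-- In M₁ the same argument applies to a and b, and a Ψ b gives 0 = b ∧ a Ψ a.
witnessed-Em : BooleanWitnessed Em
witnessed-Em = witnessed-simple Em simple
  where
  simple : ∀ (Ψ : Congruence opsEm) x y → Congruence._≈_ Ψ x y → x ≡ y ⊎ Congruence._≈_ Ψ oM iM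
  simple Ψ = go
    where
    open Congruence Ψ
    open IsEquivalence isEquiv renaming (refl to ≈refl; sym to ≈sym; trans to ≈trans)
    o~a : oM ≈ aM → oM ≈ iM
    o~a r = ≈trans r (≈sym (°-cong r))
    o~b : oM ≈ bM → oM ≈ iM
    o~b r = ≈trans r (≈sym (°-cong r))
    a~b : aM ≈ bM → oM ≈ iM
    a~b r = o~a (≈sym (∧-cong r (≈refl {aM})))
    go : ∀ x y → x ≈ y → x ≡ y ⊎ oM ≈ iM
    go oM oM r = inj₁ refl
    go oM aM r = inj₂ (o~a r)
    go oM bM r = inj₂ (o~b r)
    go oM iM r = inj₂ r
    go aM oM r = inj₂ (o~a (≈sym r))
    go aM aM r = inj₁ refl
    go aM bM r = inj₂ (a~b r)
    go aM iM r = inj₂ (o~a (≈sym (°-cong r)))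
    go bM oM r = inj₂ (o~b (≈sym r))
    go bM aM r = inj₂ (a~b (≈sym r))
    go bM bM r = inj₁ refl
    go bM iM r = inj₂ (o~b (≈sym (°-cong r)))
    go iM oM r = inj₂ (≈sym r)
    go iM aM r = inj₂ (o~a (°-cong r))
    go iM bM r = inj₂ (o~b (°-cong r))
    go iM iM r = inj₁ refl

-- Products: restrict Ψ to each factor (via a ↦ (a , 0) and c ↦ (0 , c)),
-- witness there, and pair the two witnesses.
witnessed-⊗ : ∀ {A C} → BooleanWitnessed A → BooleanWitnessed C → BooleanWitnessed (A ⊗ C)
witnessed-⊗ {A} {C} wA wC Ψ (x₁ , x₂) (y₁ , y₂) r
  with wA Ψ₁ x₁ y₁ (cresp Ψ (cong₂ _,_ (A.∧-identity x₁) (LC.∧-zeroʳ x₂))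
                             (cong₂ _,_ (A.∧-identity y₁) (LC.∧-zeroʳ y₂))
                             (∧-cong r (≈refl {A.1# , C.0#})))
     | wC Ψ₂ x₂ y₂ (cresp Ψ (cong₂ _,_ (LA.∧-zeroʳ x₁) (C.∧-identity x₂))
                             (cong₂ _,_ (LA.∧-zeroʳ y₁) (C.∧-identity y₂))
                             (∧-cong r (≈refl {A.0# , C.1#})))
  where
  module A = DeMorgan A
  module C = DeMorgan C
  module LA = Laws A
  module LC = Laws C
  open Congruence Ψ
  open IsEquivalence isEquiv renaming (refl to ≈refl; sym to ≈sym; trans to ≈trans)
  Ψ₁ : Congruence A.ops
  Ψ₁ = record
    { _≈_ = λ a a' → (a , C.0#) ≈ (a' , C.0#)
    ; isEquiv = record { refl = ≈refl ; sym = ≈sym ; trans = ≈trans }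
    ; ∨-cong = λ r s → cresp Ψ (cong (_ ,_) (C.∨-identity C.0#)) (cong (_ ,_) (C.∨-identity C.0#)) (∨-cong r s)
    ; ∧-cong = λ r s → cresp Ψ (cong (_ ,_) (LC.∧-idem C.0#)) (cong (_ ,_) (LC.∧-idem C.0#)) (∧-cong r s)
    ; °-cong = λ r → cresp Ψ (cong₂ _,_ (A.∧-identity _) (LC.∧-zeroʳ _))
                           (cong₂ _,_ (A.∧-identity _) (LC.∧-zeroʳ _))
                      (∧-cong (°-cong r) (≈refl {A.1# , C.0#})) }
  Ψ₂ : Congruence C.ops
  Ψ₂ = record
    { _≈_ = λ c c' → (A.0# , c) ≈ (A.0# , c')
    ; isEquiv = record { refl = ≈refl ; sym = ≈sym ; trans = ≈trans }
    ; ∨-cong = λ r s → cresp Ψ (cong (_, _) (A.∨-identity A.0#)) (cong (_, _) (A.∨-identity A.0#)) (∨-cong r s)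
    ; ∧-cong = λ r s → cresp Ψ (cong (_, _) (LA.∧-idem A.0#)) (cong (_, _) (LA.∧-idem A.0#)) (∧-cong r s)
    ; °-cong = λ r → cresp Ψ (cong₂ _,_ (LA.∧-zeroʳ _) (C.∧-identity _))
                           (cong₂ _,_ (LA.∧-zeroʳ _) (C.∧-identity _))
                      (∧-cong (°-cong r) (≈refl {A.0# , C.1#})) }
... | f₁ , p₁ , s₁ , e₁ | f₂ , p₂ , s₂ , e₂ =
  (f₁ , f₂) , cong₂ _,_ p₁ p₂ ,
  cresp Ψ (cong₂ _,_ (A.∨-identity f₁) (LC.∨-identityˡ f₂))
          (cong₂ _,_ (A.∨-identity A.1#) (LC.∨-identityˡ C.1#)) (∨-cong s₁ s₂) ,
  cong₂ _,_ e₁ e₂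
  where
  module A = DeMorgan A
  module C = DeMorgan C
  module LC = Laws C
  open Congruence Ψ

witnessed-∏ : ∀ cs → BooleanWitnessed (∏ cs)
witnessed-∏ [] = witnessed-Unit
witnessed-∏ (two ∷ cs) = witnessed-⊗ {Two} {∏ cs} witnessed-Two (witnessed-∏ cs)
witnessed-∏ (three ∷ cs) = witnessed-⊗ {Three} {∏ cs} witnessed-Three (witnessed-∏ cs)
witnessed-∏ (m₁ ∷ cs) = witnessed-⊗ {Em} {∏ cs} witnessed-Em (witnessed-∏ cs)

-- Decidable equality of the finite products; it gives uniqueness of the
-- proofs of membership in B(M), needed for the canonical extension.
decTwo : DecidableEquality TwoE
decTwo o2 o2 = yes refl
decTwo o2 i2 = no λ ()
decTwo i2 o2 = no λ ()
decTwo i2 i2 = yes refl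

decThree : DecidableEquality ThreeE
decThree o3 o3 = yes refl
decThree o3 a3 = no λ ()
decThree o3 i3 = no λ ()
decThree a3 o3 = no λ ()
decThree a3 a3 = yes refl
decThree a3 i3 = no λ ()
decThree i3 o3 = no λ ()
decThree i3 a3 = no λ ()
decThree i3 i3 = yes refl

decEm : DecidableEquality EmE
decEm oM oM = yes refl
decEm aM aM = yes refl
decEm bM bM = yes refl
decEm iM iM = yes refl
decEm oM aM = no λ ()
decEm oM bM = no λ ()
decEm oM iM = no λ ()
decEm aM oM = no λ ()
decEm aM bM = no λ ()
decEm aM iM = no λ ()
decEm bM oM = no λ ()
decEm bM aM = no λ ()
decEm bM iM = no λ ()
decEm iM oM = no λ ()
decEm iM aM = no λ ()
decEm iM bM = no λ ()

dec∏ : ∀ cs → DecidableEquality (DeMorgan.Carrier (∏ cs))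
dec∏ [] tt tt = yes refl
dec∏ (c ∷ cs) (a , u) (b , v) with decFactor c a b | dec∏ cs u v
  where
  decFactor : ∀ c → DecidableEquality (DeMorgan.Carrier ⟦ c ⟧)
  decFactor two = decTwo
  decFactor three = decThree
  decFactor m₁ = decEm
... | yes refl | yes refl = yes refl
... | no a≢b   | _        = no λ { refl → a≢b refl }
... | yes _    | no u≢v   = no λ { refl → u≢v refl }

dec-iso : ∀ {M N} → Iso M N → DecidableEquality (DeMorgan.Carrier N) → DecidableEquality (DeMorgan.Carrier M)
dec-iso i d x y with d (Iso.to i x) (Iso.to i y)
... | yes e = yes (trans (sym (Iso.from-to i x)) (trans (cong (Iso.from i) e) (Iso.from-to i y)))
... | no n = no λ e → n (cong (Iso.to i) e)

InB-irrelevant : ∀ (M : DeMorgan) → DecidableEquality (DeMorgan.Carrier M) →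
                 ∀ {x} (p q : Skeleton.InB M x) → p ≡ q
InB-irrelevant M d = Decidable⇒UIP.≡-irrelevant d

product⇒perfect : ∀ (M : DeMorgan) → (∃ λ (factors : List Factor) → M ≅ ∏ factors) →
                  PerfectExtensionOfSkeleton M
product⇒perfect M (cs , M≅∏) =
  CanonicalExtension.witnessed⇒perfect M (InB-irrelevant M (dec-iso i (dec∏ cs)))
                                         (witnessed-iso i (witnessed-∏ cs))
  where i = ≅→Iso M≅∏

record FinEnum (M : DeMorgan) : Set where
  field
    dec      : DecidableEquality (DeMorgan.Carrier M)
    enum     : List (DeMorgan.Carrier M)
    complete : ∀ x → x ∈ enum

module Interval (M : DeMorgan) (dec : DecidableEquality (DeMorgan.Carrier M))
                (e : DeMorgan.Carrier M) (pe : Skeleton.InB M e) where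
  open DeMorgan M
  open Laws M

  DC : Set
  DC = Σ Carrier (λ x → (x ∧ e) ≡ x)

  D-≡ : ∀ {u v : DC} → proj₁ u ≡ proj₁ v → u ≡ v
  D-≡ {x , p} {.x , q} refl = cong (x ,_) (Decidable⇒UIP.≡-irrelevant dec p q)

  down : Carrier → DC
  down x = x ∧ e , trans (∧-assoc x e e) (cong (x ∧_) (∧-idem e))

  opsD : DMOps
  opsD = record
    { Carrier = DC
    ; _∨_ = λ { (x , p) (y , q) → x ∨ y , trans (∧-distribʳ e x y) (cong₂ _∨_ p q) }
    ; _∧_ = λ { (x , p) (y , q) → x ∧ y , trans (∧-assoc x y e) (cong (x ∧_) q) }
    ; _° = λ { (x , p) → down (x °) }
    ; 0# = 0# , ∧-zeroˡ e
    ; 1# = e , ∧-idem e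
    }

  isDeMorganD : IsDeMorgan opsD
  isDeMorganD = record
    { ∨-assoc = λ x y z → D-≡ (∨-assoc (proj₁ x) (proj₁ y) (proj₁ z))
    ; ∨-comm = λ x y → D-≡ (∨-comm (proj₁ x) (proj₁ y))
    ; ∧-assoc = λ x y z → D-≡ (∧-assoc (proj₁ x) (proj₁ y) (proj₁ z))
    ; ∧-comm = λ x y → D-≡ (∧-comm (proj₁ x) (proj₁ y))
    ; ∨-absorbs-∧ = λ x y → D-≡ (∨-absorbs-∧ (proj₁ x) (proj₁ y))
    ; ∧-absorbs-∨ = λ x y → D-≡ (∧-absorbs-∨ (proj₁ x) (proj₁ y))
    ; ∧-distrib-∨ = λ x y z → D-≡ (∧-distrib-∨ (proj₁ x) (proj₁ y) (proj₁ z))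
    ; ∨-identity = λ x → D-≡ (∨-identity (proj₁ x))
    ; ∧-identity = λ { (x , p) → D-≡ p }
    ; °-deMorgan = λ { (x , p) (y , q) →
        D-≡ (trans (cong (_∧ e) (°-deMorgan x y)) (∧-distribʳ e (x °) (y °))) }
    ; °-1 = D-≡ (complˡ e pe)
    ; °-involutive = λ { (x , p) →
        D-≡ (trans (°-meet (x °) e pe) (trans (cong (_∧ e) (°-involutive x)) p)) }
    }

  D : DeMorgan
  D = record { ops = opsD ; isDeMorgan = isDeMorganD }

  down-hom : IsHomomorphism M D down
  down-hom = record
    { ∨-homo = λ x y → D-≡ (∧-distribʳ e x y)
    ; ∧-homo = λ x y → D-≡ (∧-dup x y e)
    ; °-homo = λ x → D-≡ (sym (°-meet x e pe))
    ; 0-homo = D-≡ (∧-zeroˡ e)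
    ; 1-homo = D-≡ (∧-identityˡ e) }

  witnessed-D : BooleanWitnessed M → BooleanWitnessed D
  witnessed-D = witnessed-image down down-hom proj₁ (λ { (x , p) → D-≡ p })

  -- If e ≠ 1 then ↓e is strictly smaller than M, since e° ∉ ↓e.
  smaller : (fe : FinEnum M) → e ≢ 1# →
            Σ (FinEnum D) (λ fd → length (FinEnum.enum fd) < length (FinEnum.enum fe))
  smaller fe e≢1 = record { dec = decD ; enum = map down below-e ; complete = complete-D } , shorter
    where
    open FinEnum fe using (enum; complete)
    decD : DecidableEquality DC
    decD (x , p) (y , q) with dec x y
    ... | yes x≡y = yes (D-≡ x≡y)
    ... | no x≢y = no λ z → x≢y (cong proj₁ z)
    below? : ∀ x → Dec ((x ∧ e) ≡ x)
    below? x = dec (x ∧ e) x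
    below-e : List Carrier
    below-e = filter below? enum
    complete-D : ∀ u → u ∈ map down below-e
    complete-D (x , p) = subst (_∈ map down below-e) (D-≡ p) (∈-map⁺ down (∈-filter⁺ below? (complete x) p))
    e°-not-below : ¬ (((e °) ∧ e) ≡ (e °))
    e°-not-below z = e≢1 (trans (sym (°-involutive e)) (trans (cong _° (trans (sym z) (complˡ e pe))) °-0))
    shorter : length (map down below-e) < length enum
    shorter = subst (_< length enum) (sym (length-map down below-e))
                    (filter-notAll below? enum (lose (complete (e °)) e°-not-below))

module Splitting (M : DeMorgan) (dec : DecidableEquality (DeMorgan.Carrier M))
                 (e : DeMorgan.Carrier M) (pe : Skeleton.InB M e) where
  open DeMorgan M
  open Skeleton M using (°∈B)
  open Laws M
  module ↓e = Interval M dec e pe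
  module ↓e° = Interval M dec (e °) (°∈B pe)

  disjoint : ∀ u g h → (u ∧ g) ≡ u → (g ∧ h) ≡ 0# → (u ∧ h) ≡ 0#
  disjoint u g h p q = trans (cong (_∧ h) (sym p)) (trans (∧-assoc u g h) (trans (cong (u ∧_) q) (∧-zeroʳ u)))

  split : Iso M (↓e.D ⊗ ↓e°.D)
  split = record
    { to = λ x → ↓e.down x , ↓e°.down x
    ; from = λ { ((u , p) , (v , q)) → u ∨ v }
    ; to-from = λ { ((u , p) , (v , q)) → cong₂ _,_
        (↓e.D-≡ (trans (∧-distribʳ e u v)
                (trans (cong₂ _∨_ p (disjoint v (e °) e q (complˡ e pe))) (∨-identity u))))
        (↓e°.D-≡ (trans (∧-distribʳ (e °) u v)
                 (trans (cong₂ _∨_ (disjoint u e (e °) p (complʳ e pe)) q) (∨-identityˡ v)))) }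
    ; from-to = λ x → trans (sym (∧-distrib-∨ x e (e °))) (trans (cong (x ∧_) pe) (∧-identity x))
    ; hom = record
      { ∨-homo = λ x y → cong₂ _,_ (∨-homo ↓e.down-hom x y) (∨-homo ↓e°.down-hom x y)
      ; ∧-homo = λ x y → cong₂ _,_ (∧-homo ↓e.down-hom x y) (∧-homo ↓e°.down-hom x y)
      ; °-homo = λ x → cong₂ _,_ (°-homo ↓e.down-hom x) (°-homo ↓e°.down-hom x)
      ; 0-homo = cong₂ _,_ (0-homo ↓e.down-hom) (0-homo ↓e°.down-hom)
      ; 1-homo = cong₂ _,_ (1-homo ↓e.down-hom) (1-homo ↓e°.down-hom) } }
    where open IsHomomorphism

θ-at : (M : DeMorgan) → DeMorgan.Carrier M → Congruence (DeMorgan.ops M)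
θ-at M c = record
  { _≈_ = λ x y → ((x ∧ c) ≡ (y ∧ c)) × ((x ∨ (c °)) ≡ (y ∨ (c °)))
  ; isEquiv = record { refl = refl , refl
                     ; sym = λ { (p , q) → sym p , sym q }
                     ; trans = λ { (p , q) (p' , q') → trans p p' , trans q q' } }
  ; ∨-cong = λ { {x} {y} {u} {v} (p , q) (p' , q') →
      trans (∧-distribʳ c x u) (trans (cong₂ _∨_ p p') (sym (∧-distribʳ c y v))) ,
      trans (∨-dup x u (c °)) (trans (cong₂ _∨_ q q') (sym (∨-dup y v (c °)))) }
  ; ∧-cong = λ { {x} {y} {u} {v} (p , q) (p' , q') →
      trans (∧-dup x u c) (trans (cong₂ _∧_ p p') (sym (∧-dup y v c))) ,
      trans (∨-distribʳ (c °) x u) (trans (cong₂ _∧_ q q') (sym (∨-distribʳ (c °) y v))) }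
  ; °-cong = λ { {x} {y} (p , q) →
      trans (°-below x) (trans (cong _° q) (sym (°-below y))) ,
      trans (sym (°-deMorgan x c)) (trans (cong _° p) (°-deMorgan y c)) }
  }
  where
  open DeMorgan M
  open Laws M
  °-below : ∀ x → ((x °) ∧ c) ≡ ((x ∨ (c °)) °)
  °-below x = sym (trans (°-∨ x (c °)) (cong ((x °) ∧_) (°-involutive c)))

module TrivialSkeleton (M : DeMorgan) (fe : FinEnum M) (witnessed : BooleanWitnessed M)
                       (trivial : ∀ e → Skeleton.InB M e → e ≡ DeMorgan.0# M ⊎ e ≡ DeMorgan.1# M) where
  open DeMorgan M
  open Skeleton M using (InB)
  open Laws M
  open FinEnum fe

  Mid : Carrier → Set
  Mid x = (x ≢ 0#) × (x ≢ 1#)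

  Mid? : ∀ x → Dec (Mid x)
  Mid? x = ¬? (dec x 0#) ×-dec ¬? (dec x 1#)

  -- Every middle element a is a fixed point of °: a θ-at (a ∧ a°) a°, and the
  -- Boolean witness is 1 (giving a = a°) or 0 (making a Boolean).
  fixed : ∀ a → Mid a → (a °) ≡ a
  fixed a (a≢0 , a≢1) with witnessed (θ-at M c) a (a °) (meets-agree , joins-agree)
    where
    c = a ∧ (a °)
    c° : (c °) ≡ (a ∨ (a °))
    c° = trans (°-deMorgan a (a °)) (trans (cong ((a °) ∨_) (°-involutive a)) (∨-comm (a °) a))
    meets-agree : (a ∧ c) ≡ ((a °) ∧ c)
    meets-agree = trans (∧-absorbˡ a (a °))
      (sym (trans (cong ((a °) ∧_) (∧-comm a (a °))) (trans (∧-absorbˡ (a °) a) (∧-comm (a °) a))))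
    joins-agree : (a ∨ (c °)) ≡ ((a °) ∨ (c °))
    joins-agree = trans (cong (a ∨_) c°) (trans (∨-absorbˡ a (a °))
      (sym (trans (cong ((a °) ∨_) (trans c° (∨-comm a (a °)))) (trans (∨-absorbˡ (a °) a) (∨-comm (a °) a)))))
  ... | f , p , t , e with trivial f p
  ... | inj₂ refl = trans (sym (∧-identity (a °))) (trans (sym e) (∧-identity a))
  ... | inj₁ refl with trivial a a-Boolean
    where
    c = a ∧ (a °)
    c≡0 : c ≡ 0#
    c≡0 = trans (sym (∧-identityˡ c)) (trans (sym (proj₁ t)) (∧-zeroˡ c))
    a-Boolean : InB a
    a-Boolean = trans (∨-comm a (a °))
      (trans (sym (trans (°-deMorgan a (a °)) (cong ((a °) ∨_) (°-involutive a))))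
             (trans (cong _° c≡0) °-0))
  ...   | inj₁ a≡0 = ⊥-elim (a≢0 a≡0)
  ...   | inj₂ a≡1 = ⊥-elim (a≢1 a≡1)

  -- Two distinct middle elements are complements of each other: a ∧ b is
  -- not 1, and if it were a middle element it would be fixed, forcing
  -- a ∨ b = a° ∨ b° = (a ∧ b)° = a ∧ b and hence a = b.
  complementary : ∀ a b → Mid a → Mid b → a ≢ b → ((a ∧ b) ≡ 0#) × ((a ∨ b) ≡ 1#)
  complementary a b ma mb a≢b = meet≡0 , join≡1
    where
    join≡meet° : (a ∨ b) ≡ ((a ∧ b) °)
    join≡meet° = trans (sym (cong₂ _∨_ (fixed a ma) (fixed b mb))) (sym (°-deMorgan a b))
    meet≡0 : (a ∧ b) ≡ 0#
    meet≡0 with dec (a ∧ b) 0# | dec (a ∧ b) 1#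
    ... | yes ab≡0 | _ = ab≡0
    ... | no _ | yes ab≡1 =
      ⊥-elim (proj₂ ma (trans (sym (∨-absorbs-∧ a b)) (trans (cong (a ∨_) ab≡1) (∨-zeroʳ a))))
    ... | no ab≢0 | no ab≢1 = ⊥-elim (a≢b (trans a≡ab (sym b≡ab)))
      where
      join≡meet : (a ∨ b) ≡ (a ∧ b)
      join≡meet = trans join≡meet° (fixed (a ∧ b) (ab≢0 , ab≢1))
      a≡ab : a ≡ (a ∧ b)
      a≡ab = trans (sym (∧-absorbs-∨ a b)) (trans (cong (a ∧_) join≡meet) (∧-absorbˡ a b))
      b≡ab : b ≡ (a ∧ b)
      b≡ab = trans (sym (∧-absorbs-∨ b a)) (trans (cong (b ∧_) (trans (∨-comm b a) join≡meet))
             (trans (cong (b ∧_) (∧-comm a b)) (trans (∧-absorbˡ b a) (∧-comm b a))))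
    join≡1 : (a ∨ b) ≡ 1#
    join≡1 = trans join≡meet° (trans (cong _° meet≡0) °-0)

  no-middle : ¬ Any Mid enum → ∀ x → x ≡ 0# ⊎ x ≡ 1#
  no-middle n x with dec x 0# | dec x 1#
  ... | yes z | _ = inj₁ z
  ... | no _ | yes z = inj₂ z
  ... | no a | no b = ⊥-elim (n (lose (complete x) (a , b)))

  isoUnit : 0# ≡ 1# → Iso Unit M
  isoUnit 0≡1 = mkIso (λ _ → 0#) hom (λ _ → tt) all-zero (λ _ → refl)
    where
    hom : IsHomomorphism Unit M (λ _ → 0#)
    hom = record { ∨-homo = λ _ _ → sym (∨-idem 0#) ; ∧-homo = λ _ _ → sym (∧-idem 0#)
                 ; °-homo = λ _ → sym (trans °-0 (sym 0≡1)) ; 0-homo = refl ; 1-homo = 0≡1 }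
    all-zero : ∀ x → 0# ≡ x
    all-zero x = sym (trans (sym (∧-identity x)) (trans (cong (x ∧_) (sym 0≡1)) (∧-zeroʳ x)))

  isoTwo : 0# ≢ 1# → (∀ x → x ≡ 0# ⊎ x ≡ 1#) → Iso Two M
  isoTwo 0≢1 zero-or-one = mkIso g hom s g-s inj
    where
    g : TwoE → Carrier
    g o2 = 0#
    g i2 = 1#
    hom : IsHomomorphism Two M g
    hom = record { ∨-homo = preserves-∨ ; ∧-homo = preserves-∧ ; °-homo = preserves-° ; 0-homo = refl ; 1-homo = refl }
      where
      preserves-∨ : ∀ x y → g (x ∨Two y) ≡ (g x ∨ g y)
      preserves-∨ o2 o2 = sym (∨-identityˡ (g o2))
      preserves-∨ o2 i2 = sym (∨-identityˡ (g i2))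
      preserves-∨ i2 o2 = sym (∨-zeroˡ (g o2))
      preserves-∨ i2 i2 = sym (∨-zeroˡ (g i2))
      preserves-∧ : ∀ x y → g (x ∧Two y) ≡ (g x ∧ g y)
      preserves-∧ o2 o2 = sym (∧-zeroˡ (g o2))
      preserves-∧ o2 i2 = sym (∧-zeroˡ (g i2))
      preserves-∧ i2 o2 = sym (∧-identityˡ (g o2))
      preserves-∧ i2 i2 = sym (∧-identityˡ (g i2))
      preserves-° : ∀ x → g (°Two x) ≡ (g x °)
      preserves-° o2 = sym °-0
      preserves-° i2 = sym °-1
    s : Carrier → TwoE
    s x with dec x 0#
    ... | yes _ = o2
    ... | no _ = i2
    g-s : ∀ x → g (s x) ≡ x
    g-s x with dec x 0#
    ... | yes z = sym z
    ... | no n with zero-or-one x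
    ...   | inj₁ z = ⊥-elim (n z)
    ...   | inj₂ z = sym z
    inj : ∀ {y y'} → g y ≡ g y' → y ≡ y'
    inj {o2} {o2} _ = refl
    inj {o2} {i2} z = ⊥-elim (0≢1 z)
    inj {i2} {o2} z = ⊥-elim (0≢1 (sym z))
    inj {i2} {i2} _ = refl

  isoThree : 0# ≢ 1# → (a : Carrier) → Mid a → (∀ x → Mid x → x ≡ a) → Iso Three M
  isoThree 0≢1 a ma only = mkIso g hom s g-s inj
    where
    fa : (a °) ≡ a
    fa = fixed a ma
    g : ThreeE → Carrier
    g o3 = 0#
    g a3 = a
    g i3 = 1#
    hom : IsHomomorphism Three M g
    hom = record { ∨-homo = preserves-∨ ; ∧-homo = preserves-∧ ; °-homo = preserves-° ; 0-homo = refl ; 1-homo = refl }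
      where
      preserves-∨ : ∀ x y → g (x ∨Three y) ≡ (g x ∨ g y)
      preserves-∨ o3 o3 = sym (∨-identityˡ (g o3))
      preserves-∨ o3 a3 = sym (∨-identityˡ (g a3))
      preserves-∨ o3 i3 = sym (∨-identityˡ (g i3))
      preserves-∨ a3 o3 = sym (∨-identity (g a3))
      preserves-∨ a3 a3 = sym (∨-idem (g a3))
      preserves-∨ a3 i3 = sym (∨-zeroʳ (g a3))
      preserves-∨ i3 o3 = sym (∨-zeroˡ (g o3))
      preserves-∨ i3 a3 = sym (∨-zeroˡ (g a3))
      preserves-∨ i3 i3 = sym (∨-zeroˡ (g i3))
      preserves-∧ : ∀ x y → g (x ∧Three y) ≡ (g x ∧ g y)
      preserves-∧ o3 o3 = sym (∧-zeroˡ (g o3))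
      preserves-∧ o3 a3 = sym (∧-zeroˡ (g a3))
      preserves-∧ o3 i3 = sym (∧-zeroˡ (g i3))
      preserves-∧ a3 o3 = sym (∧-zeroʳ (g a3))
      preserves-∧ a3 a3 = sym (∧-idem (g a3))
      preserves-∧ a3 i3 = sym (∧-identity (g a3))
      preserves-∧ i3 o3 = sym (∧-identityˡ (g o3))
      preserves-∧ i3 a3 = sym (∧-identityˡ (g a3))
      preserves-∧ i3 i3 = sym (∧-identityˡ (g i3))
      preserves-° : ∀ x → g (°Three x) ≡ (g x °)
      preserves-° o3 = sym °-0
      preserves-° a3 = sym fa
      preserves-° i3 = sym °-1
    s : Carrier → ThreeE
    s x with dec x 0# | dec x 1#
    ... | yes _ | _ = o3
    ... | no _ | yes _ = i3
    ... | no _ | no _ = a3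
    g-s : ∀ x → g (s x) ≡ x
    g-s x with dec x 0# | dec x 1#
    ... | yes z | _ = sym z
    ... | no _ | yes z = sym z
    ... | no p | no q = sym (only x (p , q))
    inj : ∀ {y y'} → g y ≡ g y' → y ≡ y'
    inj {o3} {o3} _ = refl
    inj {o3} {a3} z = ⊥-elim (proj₁ ma (sym z))
    inj {o3} {i3} z = ⊥-elim (0≢1 z)
    inj {a3} {o3} z = ⊥-elim (proj₁ ma z)
    inj {a3} {a3} _ = refl
    inj {a3} {i3} z = ⊥-elim (proj₂ ma z)
    inj {i3} {o3} z = ⊥-elim (0≢1 (sym z))
    inj {i3} {a3} z = ⊥-elim (proj₂ ma (sym z))
    inj {i3} {i3} _ = refl

  isoEm : 0# ≢ 1# → (a b : Carrier) → Mid a → Mid b → a ≢ b → Iso Em M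
  isoEm 0≢1 a b ma mb a≢b = mkIso g hom s g-s inj
    where
    fa : (a °) ≡ a
    fa = fixed a ma
    fb : (b °) ≡ b
    fb = fixed b mb
    ab : ((a ∧ b) ≡ 0#) × ((a ∨ b) ≡ 1#)
    ab = complementary a b ma mb a≢b
    g : EmE → Carrier
    g oM = 0#
    g aM = a
    g bM = b
    g iM = 1#
    hom : IsHomomorphism Em M g
    hom = record { ∨-homo = preserves-∨ ; ∧-homo = preserves-∧ ; °-homo = preserves-° ; 0-homo = refl ; 1-homo = refl }
      where
      preserves-∨ : ∀ x y → g (x ∨Em y) ≡ (g x ∨ g y)
      preserves-∨ oM oM = sym (∨-identityˡ (g oM))
      preserves-∨ oM aM = sym (∨-identityˡ (g aM))
      preserves-∨ oM bM = sym (∨-identityˡ (g bM))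
      preserves-∨ oM iM = sym (∨-identityˡ (g iM))
      preserves-∨ aM oM = sym (∨-identity (g aM))
      preserves-∨ aM aM = sym (∨-idem (g aM))
      preserves-∨ aM bM = sym (proj₂ ab)
      preserves-∨ aM iM = sym (∨-zeroʳ (g aM))
      preserves-∨ bM oM = sym (∨-identity (g bM))
      preserves-∨ bM aM = sym (trans (∨-comm b a) (proj₂ ab))
      preserves-∨ bM bM = sym (∨-idem (g bM))
      preserves-∨ bM iM = sym (∨-zeroʳ (g bM))
      preserves-∨ iM oM = sym (∨-zeroˡ (g oM))
      preserves-∨ iM aM = sym (∨-zeroˡ (g aM))
      preserves-∨ iM bM = sym (∨-zeroˡ (g bM))
      preserves-∨ iM iM = sym (∨-zeroˡ (g iM))
      preserves-∧ : ∀ x y → g (x ∧Em y) ≡ (g x ∧ g y)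
      preserves-∧ oM oM = sym (∧-zeroˡ (g oM))
      preserves-∧ oM aM = sym (∧-zeroˡ (g aM))
      preserves-∧ oM bM = sym (∧-zeroˡ (g bM))
      preserves-∧ oM iM = sym (∧-zeroˡ (g iM))
      preserves-∧ aM oM = sym (∧-zeroʳ (g aM))
      preserves-∧ aM aM = sym (∧-idem (g aM))
      preserves-∧ aM bM = sym (proj₁ ab)
      preserves-∧ aM iM = sym (∧-identity (g aM))
      preserves-∧ bM oM = sym (∧-zeroʳ (g bM))
      preserves-∧ bM aM = sym (trans (∧-comm b a) (proj₁ ab))
      preserves-∧ bM bM = sym (∧-idem (g bM))
      preserves-∧ bM iM = sym (∧-identity (g bM))
      preserves-∧ iM oM = sym (∧-identityˡ (g oM))
      preserves-∧ iM aM = sym (∧-identityˡ (g aM))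
      preserves-∧ iM bM = sym (∧-identityˡ (g bM))
      preserves-∧ iM iM = sym (∧-identityˡ (g iM))
      preserves-° : ∀ x → g (°Em x) ≡ (g x °)
      preserves-° oM = sym °-0
      preserves-° aM = sym fa
      preserves-° bM = sym fb
      preserves-° iM = sym °-1
    s : Carrier → EmE
    s x with dec x 0# | dec x 1# | dec x a
    ... | yes _ | _ | _ = oM
    ... | no _ | yes _ | _ = iM
    ... | no _ | no _ | yes _ = aM
    ... | no _ | no _ | no _ = bM
    g-s : ∀ x → g (s x) ≡ x
    g-s x with dec x 0# | dec x 1# | dec x a
    ... | yes z | _ | _ = sym z
    ... | no _ | yes z | _ = sym z
    ... | no _ | no _ | yes z = sym z
    ... | no p | no q | no r = compl-unique (proj₁ ab) (proj₂ ab) (proj₁ ax) (proj₂ ax)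
      where
      -- like b, any further middle element x is a complement of a
      ax : ((a ∧ x) ≡ 0#) × ((a ∨ x) ≡ 1#)
      ax = complementary a x ma (p , q) (λ z → r (sym z))
    inj : ∀ {y y'} → g y ≡ g y' → y ≡ y'
    inj {oM} {oM} _ = refl
    inj {oM} {aM} z = ⊥-elim (proj₁ ma (sym z))
    inj {oM} {bM} z = ⊥-elim (proj₁ mb (sym z))
    inj {oM} {iM} z = ⊥-elim (0≢1 z)
    inj {aM} {oM} z = ⊥-elim (proj₁ ma z)
    inj {aM} {aM} _ = refl
    inj {aM} {bM} z = ⊥-elim (a≢b z)
    inj {aM} {iM} z = ⊥-elim (proj₂ ma z)
    inj {bM} {oM} z = ⊥-elim (proj₁ mb z)
    inj {bM} {aM} z = ⊥-elim (a≢b (sym z))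
    inj {bM} {bM} _ = refl
    inj {bM} {iM} z = ⊥-elim (proj₂ mb z)
    inj {iM} {oM} z = ⊥-elim (0≢1 (sym z))
    inj {iM} {aM} z = ⊥-elim (proj₂ ma (sym z))
    inj {iM} {bM} z = ⊥-elim (proj₂ mb (sym z))
    inj {iM} {iM} _ = refl

  -- M has no middle element, exactly one, or (by compl-unique applied to
  -- complementary) at most two.
  classify : ∃ λ cs → Iso (∏ cs) M
  classify with dec 0# 1#
  ... | yes z = [] , isoUnit z
  ... | no 0≢1 with any? Mid? enum
  ...   | no none = (two ∷ []) , Iso-trans (Iso-unitʳ {Two}) (isoTwo 0≢1 (no-middle none))
  ...   | yes anyA with satisfied anyA
  ...     | a , ma with any? (λ x → Mid? x ×-dec ¬? (dec x a)) enum
  ...       | no none = (three ∷ []) , Iso-trans (Iso-unitʳ {Three}) (isoThree 0≢1 a ma only)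
    where
    only : ∀ x → Mid x → x ≡ a
    only x mx with dec x a
    ... | yes z = z
    ... | no n = ⊥-elim (none (lose (complete x) (mx , n)))
  ...       | yes anyB with satisfied anyB
  ...         | b , mb , b≢a = (m₁ ∷ []) , Iso-trans (Iso-unitʳ {Em}) (isoEm 0≢1 a b ma mb (λ z → b≢a (sym z)))


module _ (M : DeMorgan) (fe : FinEnum M) where
  open DeMorgan M
  open Skeleton M using (InB)
  open FinEnum fe

  Boolean-split? : (∃ λ e → InB e × e ≢ 0# × e ≢ 1#) ⊎ (∀ e → InB e → e ≡ 0# ⊎ e ≡ 1#)
  Boolean-split? with any? (λ e → dec (e ∨ (e °)) 1# ×-dec (¬? (dec e 0#) ×-dec ¬? (dec e 1#))) enum
  ... | yes found = inj₁ (satisfied found)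
  ... | no none = inj₂ trivial
    where
    trivial : ∀ e → InB e → e ≡ 0# ⊎ e ≡ 1#
    trivial e pe with dec e 0# | dec e 1#
    ... | yes e≡0 | _ = inj₁ e≡0
    ... | no _ | yes e≡1 = inj₂ e≡1
    ... | no e≢0 | no e≢1 = ⊥-elim (none (lose (complete e) (pe , e≢0 , e≢1)))

nonempty : ∀ {A : Set} {x : A} {xs : List A} → x ∈ xs → ¬ (length xs ≤ 0)
nonempty (here _) ()
nonempty (there _) ()

decompose : ∀ n (M : DeMorgan) (fe : FinEnum M) → length (FinEnum.enum fe) ≤ n →
            BooleanWitnessed M → ∃ λ cs → Iso (∏ cs) M
decompose zero M fe size≤0 _ = ⊥-elim (nonempty (FinEnum.complete fe (DeMorgan.0# M)) size≤0)
decompose (suc n) M fe size≤n+1 witnessed with Boolean-split? M fe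
... | inj₂ trivial = TrivialSkeleton.classify M fe witnessed trivial
... | inj₁ (e , pe , e≢0 , e≢1) = (proj₁ left ++ proj₁ right) ,
      Iso-trans (Iso-++ (proj₁ left) (proj₁ right))
        (Iso-trans (Iso-⊗ (proj₂ left) (proj₂ right)) (Iso-sym split))
  where
  open DeMorgan M
  open Splitting M (FinEnum.dec fe) e pe
  e°≢1 : (e °) ≢ 1#
  e°≢1 e°≡1 = e≢0 (trans (sym (°-involutive e)) (trans (cong _° e°≡1) °-1))
  enum-↓e : Σ (FinEnum ↓e.D) λ fd → length (FinEnum.enum fd) < length (FinEnum.enum fe)
  enum-↓e = ↓e.smaller fe e≢1
  enum-↓e° : Σ (FinEnum ↓e°.D) λ fd → length (FinEnum.enum fd) < length (FinEnum.enum fe)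
  enum-↓e° = ↓e°.smaller fe e°≢1
  fits : ∀ {k} → k < length (FinEnum.enum fe) → k ≤ n
  fits k<size = ≤-pred (<-≤-trans k<size size≤n+1)
  left : ∃ λ cs → Iso (∏ cs) ↓e.D
  left = decompose n ↓e.D (proj₁ enum-↓e) (fits (proj₂ enum-↓e)) (↓e.witnessed-D witnessed)
  right : ∃ λ cs → Iso (∏ cs) ↓e°.D
  right = decompose n ↓e°.D (proj₁ enum-↓e°) (fits (proj₂ enum-↓e°)) (↓e°.witnessed-D witnessed)

finEnum : ∀ (M : DeMorgan) → Finite M → FinEnum M
finEnum M (n , M↔Fin) = record { dec = dec ; enum = map from (allFin n) ; complete = complete }
  where
  open Inverse M↔Fin
  from-to : ∀ x → from (to x) ≡ x
  from-to x = inverseʳ refl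
  dec : DecidableEquality (DeMorgan.Carrier M)
  dec x y with to x ≟ᶠ to y
  ... | yes e = yes (trans (sym (from-to x)) (trans (cong from e) (from-to y)))
  ... | no n = no λ z → n (cong to z)
  complete : ∀ x → x ∈ map from (allFin n)
  complete x = subst (_∈ map from (allFin n)) (from-to x) (∈-map⁺ from (∈-allFin (to x)))

mainTheorem3 : (M : DeMorgan) → Finite M →
    (PerfectExtensionOfSkeleton M ⇔ ∃ λ (factors : List Factor) → M ≅ ∏ factors)
mainTheorem3 M finite = mk⇔ perfect⇒product (product⇒perfect M)
  where
  fe : FinEnum M
  fe = finEnum M finite
  perfect⇒product : PerfectExtensionOfSkeleton M → ∃ λ (factors : List Factor) → M ≅ ∏ factors
  perfect⇒product perfect =
    map₂ (λ ∏≅M → Iso→≅ (Iso-sym ∏≅M))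
         (decompose _ M fe ≤-refl
           (CanonicalExtension.perfect⇒witnessed M (InB-irrelevant M (FinEnum.dec fe)) perfect))
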